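{- The linear map $\mathcal{D}_2:\mathrm{HSym}\to\mathrm{RQSym}$ given by $\mathcal{D}_2(\pi)=F_{\mathrm{wcomp}(\pi)}$ is a Hopf algebra homomorphism, where $\mathrm{HSym}$ carries the weight $-1$ Hopf algebra structure.
   Context: $\mathfrak{B}_n$ is the set of permutations $\pi$ of $\{ -n,\dots,n\}$ with $\pi(-i)=-\pi(i)$, written as words $\pi_1\cdots\pi_n$, $\mathfrak{B}_0=\{\imath\}$. $\mathrm{st}$ of a word $a_1\cdots a_n$ over $\mathbb{Z}\setminus\{0\}$ is the unique $b_1\cdots b_n\in\mathfrak{B}_n$ with $\mathrm{sign}(b_i)=\mathrm{sign}(a_i)$ and $|b_i|<|b_j|$ whenever $|a_i|<|a_j|$ or ($|a_i|=|a_j|$, $i<j$), extended linearly. $\mathrm{HSym}=\bigoplus_n\mathbf{k}\mathfrak{B}_n$ has product $\sigma\overline{\star}_{ -1}\tau=\mathrm{st}(\sigma\star_{ -1}\tau[m])$ for $\sigma\in\mathfrak{B}_m$, where $\tau[m]$ replaces positive letters $i$ by $i+m$ and negative letters $-i$ by $-(i+m)$, and $\star_{ -1}$ is the bilinear product on words over $\mathbb{Z}\setminus\{0\}$ with the empty word as identity and $au\star_{ -1}bv=a(u\star_{ -1}bv)+b(au\star_{ -1}v)-(a\bullet b)(u\star_{ -1}v)$, $a\bullet b=a$ if $a,b<0$ and $0$ otherwise; coproduct $\Delta(\sigma)=\sum_{p=0}^m\mathrm{st}(\sigma_1\cdots\sigma_p)\otimes\mathrm{st}(\sigma_{p+1}\cdots\sigma_m)$;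 counit $\epsilon(\sigma)=\delta_{\sigma,\imath}$. $\widetilde{\mathbb{N}}=\mathbb{N}\cup\{\varepsilon\}$ with $0+\varepsilon=\varepsilon+\varepsilon=\varepsilon$, $n+\varepsilon=n$ for $n\ge1$; monomials in commuting $x_1,x_2,\dots$ have exponents in $\widetilde{\mathbb{N}}$ ($x^0=1$, $x^ax^b=x^{a+b}$). A regularized composition is a finite sequence $\alpha=(\alpha_1,\dots,\alpha_\ell)$ of elements of $\mathbb{P}\cup\{\varepsilon\}$. $M_\alpha=\sum_{j_1<\cdots<j_\ell}x_{j_1}^{\alpha_1}\cdots x_{j_\ell}^{\alpha_\ell}$, $M_\emptyset=1$; $\mathrm{RQSym}$ is their span, a Hopf algebra with product multiplication of series, coproduct $\Delta_R(M_\alpha)=\sum_{\alpha=\beta\cdot\gamma}M_\beta\otimes M_\gamma$ ($\cdot$ = concatenation) and counit $\epsilon_R(M_\alpha)=\delta_{\alpha,\emptyset}$. Writing $\alpha=(\varepsilon^{i_1},s_1,\dots,\varepsilon^{i_k},s_k,\varepsilon^{i_{k+1}})$ with $s_q\in\mathbb{P}$, let $n=\sum i_p+\sum s_q$, $D(\alpha)=\{\sum_{j\le q}(i_j+s_j):q\in[k]\}$, $(e_1,\dots,e_n)=(\varepsilon^{i_1},1^{s_1},\dots,\varepsilon^{i_k},1^{s_k},\varepsilon^{i_{k+1}})$, and $F_\alpha=\sum x_{j_1}^{e_1}\cdots x_{j_n}^{e_n}$ over $j_1\le\cdots\le j_n$ with $j_p<j_{p+1}$ whenever $p\in D(\alpha)$,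 $p<n$ ($F_\emptyset=1$). For a word $w=w_1\cdots w_r$ of distinct positive integers, $\mathrm{comp}(w)$ is the composition of $r$ with set of partial sums $\{i\in[r-1]:w_i>w_{i+1}\}\cup\{r\}$. For $\pi\in\mathfrak{B}_n$ write $\pi=(N_1,B_1,\dots,N_k,B_k,N_{k+1})$ with $B_q$ the maximal nonempty runs of consecutive positive entries and $N_p$ consisting of $i_p\ge0$ negative entries; $\mathrm{wcomp}(\pi)=(\varepsilon^{i_1},\mathrm{comp}(B_1),\dots,\varepsilon^{i_k},\mathrm{comp}(B_k),\varepsilon^{i_{k+1}})$. -}

module Defs where

open import Data.Bool using (Bool; true; false; _∧_; _∨_; if_then_else_)
open import Data.Nat as ℕ using (ℕ; zero; suc; _<ᵇ_; _≤ᵇ_; _≡ᵇ_)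
open import Data.Integer as ℤ using (ℤ; +_; -[1+_]; ∣_∣; 0ℤ; 1ℤ)
open import Data.List using (List; []; _∷_; _++_; map; length; foldr; concatMap; upTo; filterᵇ; zip; take; drop; replicate)
open import Data.List.Relation.Binary.Permutation.Propositional using (_↭_)
open import Data.List.Relation.Unary.All using (All)
open import Data.Vec using (Vec; tabulate)
import Data.Vec as V
import Data.Vec.Properties as VecP
open import Data.Fin using (Fin; toℕ)
open import Data.Product using (_×_; _,_; proj₁; proj₂)
open import Relation.Binary.PropositionalEquality using (_≡_; _≢_; refl; cong)
open import Relation.Nullary using (yes; no; does)
open import Relation.Binary.Definitions using (DecidableEquality)

Word : Set
Word = List ℤ

-- σ ∈ 𝔅_n, written as the word σ₁⋯σₙ: the absolute values form a
-- permutation of 1,…,n (so in particular no letter is 0).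
IsSignedPerm : ℕ → Word → Set
IsSignedPerm n σ = map ∣_∣ σ ↭ map suc (upTo n)

ı : Word
ı = []

isNeg : ℤ → Bool
isNeg -[1+ _ ] = true
isNeg (+ _)    = false

LinComb : Set → Set
LinComb A = List (ℤ × A)

indexed : Word → List (ℕ × ℤ)
indexed w = zip (upTo (length w)) w

rank : List (ℕ × ℤ) → ℕ × ℤ → ℕ
rank ia (i , a) =
  suc (length (filterᵇ
        (λ { (j , b) → (∣ b ∣ <ᵇ ∣ a ∣) ∨ ((∣ b ∣ ≡ᵇ ∣ a ∣) ∧ (j <ᵇ i)) }) ia))

signed : ℤ → ℕ → ℤ
signed a r = if isNeg a then ℤ.- (+ r) else + r

st : Word → Word
st w = map (λ p → signed (proj₂ p) (rank (indexed w) p)) (indexed w)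

stLin : LinComb Word → LinComb Word
stLin = map (λ { (c , w) → (c , st w) })

prepend : ℤ → LinComb Word → LinComb Word
prepend a = map (λ { (c , w) → (c , a ∷ w) })

negateLC : LinComb Word → LinComb Word
negateLC = map (λ { (c , w) → (ℤ.- c , w) })

-- au ⋆ bv = a(u ⋆ bv) + b(au ⋆ v) − (a•b)(u ⋆ v),
-- a•b = a if a,b < 0, and 0 (the term vanishes) otherwise.
_⋆_ : Word → Word → LinComb Word
[] ⋆ v = (1ℤ , v) ∷ []
(a ∷ u) ⋆ [] = (1ℤ , a ∷ u) ∷ []
(a ∷ u) ⋆ (b ∷ v) =
  prepend a (u ⋆ (b ∷ v)) ++ prepend b ((a ∷ u) ⋆ v)
  ++ (if isNeg a ∧ isNeg b then negateLC (prepend a (u ⋆ v)) else [])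

shift : ℕ → Word → Word
shift m = map (λ x → if isNeg x then x ℤ.- + m else x ℤ.+ + m)

-- product of HSym on basis elements: σ ⋆̄ τ = st(σ ⋆₋₁ τ[m]), σ ∈ 𝔅_m
_⋆̄_ : Word → Word → LinComb Word
σ ⋆̄ τ = stLin (σ ⋆ shift (length σ) τ)

ΔH : Word → List (Word × Word)
ΔH σ = map (λ p → (st (take p σ) , st (drop p σ))) (upTo (suc (length σ)))

data Ñ : Set where
  ε   : Ñ
  nat : ℕ → Ñ

_⊕_ : Ñ → Ñ → Ñ
ε ⊕ ε = ε
ε ⊕ nat zero = ε
ε ⊕ nat (suc n) = nat (suc n)
nat zero ⊕ ε = ε
nat (suc n) ⊕ ε = nat (suc n)
nat a ⊕ nat b = nat (a ℕ.+ b)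

_≟Ñ_ : DecidableEquality Ñ
ε ≟Ñ ε = yes refl
ε ≟Ñ nat _ = no (λ ())
nat _ ≟Ñ ε = no (λ ())
nat a ≟Ñ nat b with a ℕ.≟ b
... | yes refl = yes refl
... | no a≢b = no (λ { refl → a≢b refl })

RComp : Set
RComp = List Ñ

IsRComp : RComp → Set
IsRComp α = All (λ a → a ≢ nat 0) α

-- Formal series in x₁,x₂,… with exponents in Ñ (coefficients in ℤ).
-- A series is given by its coefficient function: f k m is the
-- coefficient of x₁^{m₁}⋯x_k^{m_k} (all other exponents 0).

Series : Set
Series = (k : ℕ) → Vec Ñ k → ℤ

_≈_ : Series → Series → Set
f ≈ g = ∀ k m → f k m ≡ g k m

0ₛ : Series
0ₛ k m = 0ℤ

1ₛ : Series
1ₛ k m with VecP.≡-dec _≟Ñ_ m (tabulate (λ _ → nat 0))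
... | yes _ = 1ℤ
... | no _ = 0ℤ

_+ₛ_ : Series → Series → Series
(f +ₛ g) k m = f k m ℤ.+ g k m

_·ₛ_ : ℤ → Series → Series
(c ·ₛ f) k m = c ℤ.* f k m

-- candidate exponents a with a ⊕ b = e for some b
candidates : Ñ → List Ñ
candidates ε = ε ∷ nat 0 ∷ []
candidates (nat n) = ε ∷ map nat (upTo (suc n))

splits : {k : ℕ} → Vec Ñ k → List (Vec Ñ k × Vec Ñ k)
splits V.[] = (V.[] , V.[]) ∷ []
splits (e V.∷ m) =
  concatMap (λ a → concatMap (λ b →
      if does ((a ⊕ b) ≟Ñ e)
      then map (λ { (as , bs) → (a V.∷ as , b V.∷ bs) }) (splits m)
      else [])
    (candidates e)) (candidates e)

sumℤ : List ℤ → ℤ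
sumℤ = foldr ℤ._+_ 0ℤ

_*ₛ_ : Series → Series → Series
(f *ₛ g) k m = sumℤ (map (λ { (a , b) → f k a ℤ.* g k b }) (splits m))

-- Generic monomial sums
--   Σ x_{j₁}^{e₁} ⋯ x_{jₙ}^{eₙ}  over j₁ ≤ ⋯ ≤ jₙ,  j_p < j_{p+1} if s_p
-- given as the list of pairs (e_p , s_p). Variables are indexed from 0
-- here (index j stands for x_{j+1}).

seqs : ℕ → ℕ → List (List ℕ)
seqs k zero = [] ∷ []
seqs k (suc n) = concatMap (λ i → map (i ∷_) (seqs k n)) (upTo k)

admissible : List Bool → List ℕ → Bool
admissible (s ∷ ss) (j ∷ j' ∷ js) =
  (if s then j <ᵇ j' else j ≤ᵇ j') ∧ admissible ss (j' ∷ js)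
admissible _ _ = true

monomial : (k : ℕ) → List ℕ → List Ñ → Vec Ñ k
monomial k js es =
  tabulate (λ i → foldr _⊕_ (nat 0)
    (map proj₂ (filterᵇ (λ p → proj₁ p ≡ᵇ toℕ i) (zip js es))))

-- A monomial involving a variable x_j with j > k has a nonzero
-- exponent (ε or ≥1) outside x₁..x_k, so only j ∈ {1..k} can contribute
-- to the coefficient of x₁^{m₁}⋯x_k^{m_k}.
monoSum : List (Ñ × Bool) → Series
monoSum es k m =
  + length (filterᵇ
      (λ js → admissible (map proj₂ es) js
              ∧ does (VecP.≡-dec _≟Ñ_ (monomial k js (map proj₁ es)) m))
      (seqs k (length es)))

M : RComp → Series
M α = monoSum (map (λ a → (a , true)) α)

-- (e₁,…,eₙ) = (ε^{i₁},1^{s₁},…) together with the flags p ∈ D(α)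
-- (the last position of each block 1^{s_q})
eData : RComp → List (Ñ × Bool)
eData [] = []
eData (ε ∷ α) = (ε , false) ∷ eData α
eData (nat zero ∷ α) = eData α
eData (nat (suc s) ∷ α) =
  replicate s (nat 1 , false) ++ (nat 1 , true) ∷ eData α

F : RComp → Series
F α = monoSum (eData α)

-- comp(w): lengths of the maximal runs between descents
compAux : ℤ → List ℤ → ℕ → List ℕ
compAux prev [] c = c ∷ []
compAux prev (x ∷ w) c with does (x ℤ.<? prev)
... | true  = c ∷ compAux x w 1
... | false = compAux x w (suc c)

comp : List ℤ → List ℕ
comp [] = []
comp (x ∷ w) = compAux x w 1

wcompAux : List ℤ → Word → RComp
wcompAux run [] = map nat (comp run)
wcompAux run (x ∷ w) =
  if isNeg x then map nat (comp run) ++ ε ∷ wcompAux [] w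
  else wcompAux (run ++ x ∷ []) w

wcomp : Word → RComp
wcomp = wcompAux []

𝒟₂ : Word → Series
𝒟₂ π = F (wcomp π)

linS : {A : Set} → (A → Series) → LinComb A → Series
linS f [] = 0ₛ
linS f ((c , a) ∷ L) = (c ·ₛ f a) +ₛ linS f L

-- RQSym ⊗ RQSym, embedded (injectively) in series in two ordered sets
-- of variables x₁,x₂,… and y₁,y₂,…: f ⊗ g ↦ f(x) g(y).

Series₂ : Set
Series₂ = (k : ℕ) → Vec Ñ k → Vec Ñ k → ℤ

_≈₂_ : Series₂ → Series₂ → Set
f ≈₂ g = ∀ k a b → f k a b ≡ g k a b

0₂ : Series₂
0₂ k a b = 0ℤ

_+₂_ : Series₂ → Series₂ → Series₂
(f +₂ g) k a b = f k a b ℤ.+ g k a b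

_·₂_ : ℤ → Series₂ → Series₂
(c ·₂ f) k a b = c ℤ.* f k a b

_⊗_ : Series → Series → Series₂
(f ⊗ g) k a b = f k a ℤ.* g k b

sum₂ : List Series₂ → Series₂
sum₂ = foldr _+₂_ 0₂

evalM : LinComb RComp → Series
evalM = linS M

ΔRM : RComp → Series₂
ΔRM α = sum₂ (map (λ i → M (take i α) ⊗ M (drop i α)) (upTo (suc (length α))))

ΔR : LinComb RComp → Series₂
ΔR [] = 0₂
ΔR ((c , α) ∷ L) = (c ·₂ ΔRM α) +₂ ΔR L

εR : LinComb RComp → ℤ
εR [] = 0ℤ
εR ((c , []) ∷ L) = c ℤ.+ εR L
εR ((c , _ ∷ _) ∷ L) = εR L

εH : Word → ℤ
εH [] = 1ℤ
εH (_ ∷ _) = 0ℤ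

𝒟₂⊗𝒟₂Δ : Word → Series₂
𝒟₂⊗𝒟₂Δ σ = sum₂ (map (λ { (u , v) → 𝒟₂ u ⊗ 𝒟₂ v }) (ΔH σ))

-- The coefficient of x₁^{m₁}⋯x_k^{m_k} in 𝒟₂(π) = F_{wcomp π} can be read
-- off π one variable at a time: x₁ absorbs a prefix of π in which no
-- positive letter is followed by a negative or a smaller positive letter,
-- picking up ε per negative and 1 per positive letter, and x₂,…,x_k read
-- the rest.  This only sees signs and the relative order of positive
-- letters, so it is invariant under st and under τ ↦ τ[m].
-- Multiplicativity: since the positive letters of σ lie below those of
-- τ[m], absorbing a prefix commutes with the quasi-shuffle σ ⋆₋₁ τ[m]:
-- when x₁ takes the first letters of both words, it is counted once in
-- a(u ⋆ bv) and once in b(au ⋆ v), and for two negative letters the term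
-- −(a•b)(u ⋆ v) removes the duplicate.  Comultiplicativity: the
-- coefficient at a concatenated exponent vector splits over the cuts of
-- the word, i.e. over deconcatenation on both sides; the counit is the
-- constant term.
-- Grouping the positions that share a variable expands F_α in the M basis.

module Submission where

open import Defs
open import Data.Nat using (ℕ)
open import Data.Integer using (ℤ)
open import Data.List using (List)
open import Data.List.Relation.Unary.All using (All)
open import Data.Product using (_×_; Σ; proj₂)
open import Relation.Binary.PropositionalEquality using (_≡_)

open import Level using (0ℓ)
open import Algebra.Bundles using (CommutativeMonoid)
open import Algebra.Structures {A = Ñ} _≡_ using (IsCommutativeMonoid)
import Algebra.Properties.CommutativeSemigroup as CommSemigroupProps
open import Data.Bool using (Bool; true; false; _∧_; _∨_; not; if_then_else_; T)
import Data.Bool.Properties as BP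
open import Data.Nat as ℕ using (zero; suc; _<ᵇ_; _≤ᵇ_; _≡ᵇ_; _≤_; _<_)
import Data.Nat.Properties as ℕP
open import Data.Integer as ℤ using (-[1+_]; 0ℤ; 1ℤ; _+_; _*_; -_; _-_; ∣_∣)
import Data.Integer.Properties as ℤP
open import Data.Integer.Tactic.RingSolver using (solve-∀)
open import Data.List using ([]; _∷_; _++_; map; length; take; drop; foldr; concatMap; upTo; applyUpTo; filterᵇ; zip; replicate)
import Data.List.Properties as LP
open import Data.List.Relation.Unary.All as All using ([]; _∷_)
import Data.List.Relation.Unary.All.Properties as AllP
open import Data.List.Relation.Unary.Linked using (Linked; []; [-]; _∷_)
open import Data.List.Relation.Unary.Any using (here; there)
open import Data.List.Membership.Propositional using (_∈_)
import Data.List.Membership.Propositional.Properties as MP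
import Data.List.Relation.Binary.Permutation.Propositional.Properties as PermP
open import Data.Vec as V using (Vec; tabulate; lookup)
import Data.Vec.Properties as VP
open import Data.Fin using (toℕ)
open import Data.Maybe using (Maybe; just; nothing)
open import Data.Product using (_,_; proj₁; ∃)
open import Data.Sum using (_⊎_; inj₁; inj₂)
open import Data.Unit using (⊤; tt)
open import Data.Empty using (⊥-elim)
open import Relation.Binary.PropositionalEquality using (_≢_; refl; sym; trans; cong; cong₂; subst; isEquivalence; module ≡-Reasoning)
open import Relation.Nullary using (yes; no; does; ¬_)
open import Relation.Nullary.Decidable using (does-⇔; dec-true; dec-false)
open import Function using (_∘_; _⇔_; Equivalence; mk⇔)

nat-⊕-nat : ∀ a b → nat a ⊕ nat b ≡ nat (a ℕ.+ b)
nat-⊕-nat zero    b = refl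
nat-⊕-nat (suc a) b = refl

⊕-identityˡ : ∀ x → nat 0 ⊕ x ≡ x
⊕-identityˡ ε       = refl
⊕-identityˡ (nat n) = refl

⊕-identityʳ : ∀ x → x ⊕ nat 0 ≡ x
⊕-identityʳ ε       = refl
⊕-identityʳ (nat n) = trans (nat-⊕-nat n 0) (cong nat (ℕP.+-identityʳ n))

⊕-comm : ∀ x y → x ⊕ y ≡ y ⊕ x
⊕-comm ε             ε             = refl
⊕-comm ε             (nat zero)    = refl
⊕-comm ε             (nat (suc n)) = refl
⊕-comm (nat zero)    ε             = refl
⊕-comm (nat (suc n)) ε             = refl
⊕-comm (nat a)       (nat b)       =
  trans (nat-⊕-nat a b) (trans (cong nat (ℕP.+-comm a b)) (sym (nat-⊕-nat b a)))

⊕-assoc : ∀ x y z → (x ⊕ y) ⊕ z ≡ x ⊕ (y ⊕ z)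
⊕-assoc (nat zero) y z rewrite ⊕-identityˡ y | ⊕-identityˡ (y ⊕ z) = refl
⊕-assoc x (nat zero) z rewrite ⊕-identityʳ x | ⊕-identityˡ z = refl
⊕-assoc x y (nat zero) rewrite ⊕-identityʳ (x ⊕ y) | ⊕-identityʳ y = refl
⊕-assoc ε ε ε = refl
⊕-assoc ε ε (nat (suc n)) = refl
⊕-assoc ε (nat (suc m)) ε = refl
⊕-assoc ε (nat (suc m)) (nat (suc n)) = refl
⊕-assoc (nat (suc l)) ε ε = refl
⊕-assoc (nat (suc l)) ε (nat (suc n)) = refl
⊕-assoc (nat (suc l)) (nat (suc m)) ε = refl
⊕-assoc (nat (suc l)) (nat (suc m)) (nat (suc n)) = cong nat (ℕP.+-assoc (suc l) (suc m) (suc n))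

⊕-isCommutativeMonoid : IsCommutativeMonoid _⊕_ (nat 0)
⊕-isCommutativeMonoid = record
  { isMonoid = record
    { isSemigroup = record
      { isMagma = record { isEquivalence = isEquivalence ; ∙-cong = cong₂ _⊕_ }
      ; assoc = ⊕-assoc }
    ; identity = ⊕-identityˡ , ⊕-identityʳ }
  ; comm = ⊕-comm }

⊕-commutativeMonoid : CommutativeMonoid 0ℓ 0ℓ
⊕-commutativeMonoid = record { isCommutativeMonoid = ⊕-isCommutativeMonoid }

open CommSemigroupProps (CommutativeMonoid.commutativeSemigroup ⊕-commutativeMonoid)
  using () renaming (x∙yz≈y∙xz to ⊕-x∙yz≈y∙xz; xy∙z≈y∙xz to ⊕-xy∙z≈y∙xz)

∑ : {A : Set} → List A → (A → ℤ) → ℤ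
∑ xs f = sumℤ (map f xs)

∑< : ℕ → (ℕ → ℤ) → ℤ
∑< zero    g = 0ℤ
∑< (suc n) g = g 0 + ∑< n (g ∘ suc)

𝟙 : Bool → ℤ
𝟙 true  = 1ℤ
𝟙 false = 0ℤ

if-0≡𝟙* : ∀ c z → (if c then z else 0ℤ) ≡ 𝟙 c * z
if-0≡𝟙* true  z = sym (ℤP.*-identityˡ z)
if-0≡𝟙* false z = sym (ℤP.*-zeroˡ z)

+-interchange : ∀ a b c d → (a + b) + (c + d) ≡ (a + c) + (b + d)
+-interchange = solve-∀

module _ {A : Set} where

  ∑-cong : ∀ (xs : List A) {f g} → (∀ x → f x ≡ g x) → ∑ xs f ≡ ∑ xs g
  ∑-cong []       eq = refl
  ∑-cong (x ∷ xs) eq = cong₂ _+_ (eq x) (∑-cong xs eq)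

  ∑-congAll : ∀ {xs : List A} {f g} → All (λ x → f x ≡ g x) xs → ∑ xs f ≡ ∑ xs g
  ∑-congAll []         = refl
  ∑-congAll (eq ∷ eqs) = cong₂ _+_ eq (∑-congAll eqs)

  ∑-++ : ∀ (xs ys : List A) f → ∑ (xs ++ ys) f ≡ ∑ xs f + ∑ ys f
  ∑-++ []       ys f = sym (ℤP.+-identityˡ _)
  ∑-++ (x ∷ xs) ys f rewrite ∑-++ xs ys f = sym (ℤP.+-assoc (f x) _ _)

  ∑-+ : ∀ (xs : List A) f g → ∑ xs (λ x → f x + g x) ≡ ∑ xs f + ∑ xs g
  ∑-+ []       f g = refl
  ∑-+ (x ∷ xs) f g rewrite ∑-+ xs f g = +-interchange (f x) (g x) _ _

  ∑-*ˡ : ∀ (xs : List A) c f → ∑ xs (λ x → c * f x) ≡ c * ∑ xs f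
  ∑-*ˡ []       c f = sym (ℤP.*-zeroʳ c)
  ∑-*ˡ (x ∷ xs) c f rewrite ∑-*ˡ xs c f = sym (ℤP.*-distribˡ-+ c (f x) _)

  ∑-*ʳ : ∀ (xs : List A) c f → ∑ xs (λ x → f x * c) ≡ ∑ xs f * c
  ∑-*ʳ []       c f = sym (ℤP.*-zeroˡ c)
  ∑-*ʳ (x ∷ xs) c f rewrite ∑-*ʳ xs c f = sym (ℤP.*-distribʳ-+ c (f x) _)

  ∑-zero : ∀ (xs : List A) → ∑ xs (λ _ → 0ℤ) ≡ 0ℤ
  ∑-zero []       = refl
  ∑-zero (x ∷ xs) = trans (ℤP.+-identityˡ _) (∑-zero xs)

  ∑-neg : ∀ (xs : List A) f → ∑ xs (λ x → - f x) ≡ - ∑ xs f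
  ∑-neg []       f = refl
  ∑-neg (x ∷ xs) f rewrite ∑-neg xs f = sym (ℤP.neg-distrib-+ (f x) _)


∑-map : ∀ {A B : Set} (g : A → B) xs f → ∑ (map g xs) f ≡ ∑ xs (f ∘ g)
∑-map g []       f = refl
∑-map g (x ∷ xs) f = cong (f (g x) +_) (∑-map g xs f)

∑-concatMap : ∀ {A B : Set} (g : A → List B) xs f → ∑ (concatMap g xs) f ≡ ∑ xs (λ x → ∑ (g x) f)
∑-concatMap g []       f = refl
∑-concatMap g (x ∷ xs) f = trans (∑-++ (g x) _ f) (cong (∑ (g x) f +_) (∑-concatMap g xs f))

∑-comm : ∀ {A B : Set} (xs : List A) (ys : List B) (f : A → B → ℤ) →
         ∑ xs (λ x → ∑ ys (f x)) ≡ ∑ ys (λ y → ∑ xs (λ x → f x y))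
∑-comm []       ys f = sym (∑-zero ys)
∑-comm (x ∷ xs) ys f =
  trans (cong (∑ ys (f x) +_) (∑-comm xs ys f)) (sym (∑-+ ys (f x) (λ y → ∑ xs (λ x' → f x' y))))

∑-applyUpTo : ∀ (h : ℕ → ℕ) n (g : ℕ → ℤ) → ∑ (applyUpTo h n) g ≡ ∑< n (g ∘ h)
∑-applyUpTo h zero    g = refl
∑-applyUpTo h (suc n) g = cong (g (h 0) +_) (∑-applyUpTo (h ∘ suc) n g)

∑-upTo : ∀ n (g : ℕ → ℤ) → ∑ (upTo n) g ≡ ∑< n g
∑-upTo = ∑-applyUpTo (λ i → i)

∑<-cong : ∀ n {f g} → (∀ i → f i ≡ g i) → ∑< n f ≡ ∑< n g
∑<-cong zero    eq = refl
∑<-cong (suc n) eq = cong₂ _+_ (eq 0) (∑<-cong n (eq ∘ suc))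

∑<-zero : ∀ n → ∑< n (λ _ → 0ℤ) ≡ 0ℤ
∑<-zero zero    = refl
∑<-zero (suc n) = trans (ℤP.+-identityˡ _) (∑<-zero n)

∑<-+ : ∀ n f g → ∑< n (λ i → f i + g i) ≡ ∑< n f + ∑< n g
∑<-+ zero    f g = refl
∑<-+ (suc n) f g rewrite ∑<-+ n (f ∘ suc) (g ∘ suc) = +-interchange (f 0) (g 0) _ _

∑<-if : ∀ n (d : Bool) (g : ℕ → ℤ) → ∑< n (λ i → if d then g i else 0ℤ) ≡ (if d then ∑< n g else 0ℤ)
∑<-if n true  g = refl
∑<-if n false g = ∑<-zero n

-- Coefficients of a monomial sum, read off one variable at a time

-- A word is read by the variables x₁, x₂, … in order: each variable
-- absorbs a prefix of what is left.  A letter x may be absorbed after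
-- state s iff  link s x,  it contributes  exp x  to the exponent, and the
-- state becomes  next x.  Every variable starts afresh in state  start.
module Peeling {A St : Set} (link : St → A → Bool) (next : A → St) (exp : A → Ñ) (start : St) where

  peel : St → List A → List (Ñ × List A)
  peel s []      = (nat 0 , []) ∷ []
  peel s (x ∷ w) =
    (nat 0 , x ∷ w) ∷ (if link s x then map (λ p → (exp x ⊕ proj₁ p , proj₂ p)) (peel (next x) w) else [])

  null : List A → Bool
  null []      = true
  null (_ ∷ _) = false

  coeff : List A → (k : ℕ) → Vec Ñ k → ℤ
  coeff w zero    V.[]       = 𝟙 (null w)
  coeff w (suc k) (e V.∷ m) = ∑ (peel start w) (λ p → if does (proj₁ p ≟Ñ e) then coeff (proj₂ p) k m else 0ℤ)

  coeff-suc : ∀ w k (m : Vec Ñ (suc k)) →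
    coeff w (suc k) m ≡ ∑ (peel start w) (λ p → 𝟙 (does (proj₁ p ≟Ñ V.head m)) * coeff (proj₂ p) k (V.tail m))
  coeff-suc w k (e V.∷ m) = ∑-cong (peel start w) (λ p → if-0≡𝟙* (does (proj₁ p ≟Ñ e)) _)

  ∑peel-∷ : ∀ s x w (Ψ : Ñ → List A → ℤ) →
    ∑ (peel s (x ∷ w)) (λ p → Ψ (proj₁ p) (proj₂ p)) ≡
    Ψ (nat 0) (x ∷ w) + (if link s x then ∑ (peel (next x) w) (λ p → Ψ (exp x ⊕ proj₁ p) (proj₂ p)) else 0ℤ)
  ∑peel-∷ s x w Ψ with link s x
  ... | true  = cong (Ψ (nat 0) (x ∷ w) +_) (∑-map _ (peel (next x) w) _)
  ... | false = refl

  peel-cong-state : ∀ s s' w → (∀ x → link s x ≡ link s' x) → peel s w ≡ peel s' w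
  peel-cong-state s s' []      h = refl
  peel-cong-state s s' (x ∷ w) h rewrite h x = refl

  peel-All : (P : List A → Set) → (∀ {x w} → P (x ∷ w) → P w) →
             ∀ s w → P w → All (λ p → P (proj₂ p)) (peel s w)
  peel-All P tail s []      pw = pw ∷ []
  peel-All P tail s (x ∷ w) pw = pw ∷ rest (link s x)
    where
    rest : ∀ b → All (λ p → P (proj₂ p)) (if b then map (λ p → (exp x ⊕ proj₁ p , proj₂ p)) (peel (next x) w) else [])
    rest true  = AllP.map⁺ (peel-All P tail (next x) w (tail pw))
    rest false = []

  -- Cutting the rest of a peel at position i is the same as peeling the
  -- first i letters and keeping the remaining ones aside.
  ∑peel-split : ∀ s w (Φ : Ñ → List A → List A → ℤ) →
    ∑ (peel s w) (λ p → ∑< (suc (length (proj₂ p))) (λ i → Φ (proj₁ p) (take i (proj₂ p)) (drop i (proj₂ p))))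
    ≡ ∑< (suc (length w)) (λ i → ∑ (peel s (take i w)) (λ p → Φ (proj₁ p) (proj₂ p) (drop i w)))
  ∑peel-split s []      Φ = refl
  ∑peel-split s (x ∷ w) Φ =
    begin
      ∑ (peel s (x ∷ w)) (λ p → ∑< (suc (length (proj₂ p))) (λ i → Φ (proj₁ p) (take i (proj₂ p)) (drop i (proj₂ p))))
    ≡⟨ ∑peel-∷ s x w (λ e u → ∑< (suc (length u)) (λ i → Φ e (take i u) (drop i u))) ⟩
      (Φ₀ + ∑< n B) + (if link s x then Rest else 0ℤ)
    ≡⟨ cong ((Φ₀ + ∑< n B) +_) (inner (link s x)) ⟩
      (Φ₀ + ∑< n B) + (if link s x then ∑< n C else 0ℤ)
    ≡⟨ ℤP.+-assoc Φ₀ _ _ ⟩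
      Φ₀ + (∑< n B + (if link s x then ∑< n C else 0ℤ))
    ≡⟨ cong₂ _+_ (sym (ℤP.+-identityʳ Φ₀)) (sym (∑<-+if (link s x))) ⟩
      (Φ₀ + 0ℤ) + ∑< n (λ i → B i + (if link s x then C i else 0ℤ))
    ≡⟨ cong ((Φ₀ + 0ℤ) +_) (∑<-cong n (λ i → sym (∑peel-∷ s x (take i w) (λ e u → Φ e u (drop i w))))) ⟩
      ∑< (suc n) (λ i → ∑ (peel s (take i (x ∷ w))) (λ p → Φ (proj₁ p) (proj₂ p) (drop i (x ∷ w))))
    ∎
    where
    open ≡-Reasoning
    n = suc (length w)
    Φ₀ = Φ (nat 0) [] (x ∷ w)
    B C : ℕ → ℤ
    B i = Φ (nat 0) (x ∷ take i w) (drop i w)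
    C i = ∑ (peel (next x) (take i w)) (λ p → Φ (exp x ⊕ proj₁ p) (proj₂ p) (drop i w))
    Rest = ∑ (peel (next x) w) (λ p → ∑< (suc (length (proj₂ p))) (λ i → Φ (exp x ⊕ proj₁ p) (take i (proj₂ p)) (drop i (proj₂ p))))
    inner : ∀ b → (if b then Rest else 0ℤ) ≡ (if b then ∑< n C else 0ℤ)
    inner true  = ∑peel-split (next x) w (λ e → Φ (exp x ⊕ e))
    inner false = refl
    ∑<-+if : ∀ b → ∑< n (λ i → B i + (if b then C i else 0ℤ)) ≡ ∑< n B + (if b then ∑< n C else 0ℤ)
    ∑<-+if true  = ∑<-+ n B C
    ∑<-+if false = trans (∑<-cong n (λ i → ℤP.+-identityʳ (B i))) (sym (ℤP.+-identityʳ _))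

  coeff-++ : ∀ i j w (a : Vec Ñ i) (b : Vec Ñ j) →
    coeff w (i ℕ.+ j) (a V.++ b) ≡ ∑< (suc (length w)) (λ p → coeff (take p w) i a * coeff (drop p w) j b)
  coeff-++ zero j [] V.[] b = sym (trans (ℤP.+-identityʳ _) (ℤP.*-identityˡ _))
  coeff-++ zero j (x ∷ w) V.[] b =
    sym (trans (cong₂ _+_ (ℤP.*-identityˡ (coeff (x ∷ w) j b))
                          (trans (∑<-cong (suc (length w)) (λ p → ℤP.*-zeroˡ (coeff (drop (suc p) (x ∷ w)) j b)))
                                 (∑<-zero (suc (length w)))))
               (ℤP.+-identityʳ _))
  coeff-++ (suc i) j w (a₀ V.∷ a) b =
    begin
      ∑ (peel start w) (λ p → if does (proj₁ p ≟Ñ a₀) then coeff (proj₂ p) (i ℕ.+ j) (a V.++ b) else 0ℤ)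
    ≡⟨ ∑-cong (peel start w) (λ p → split (proj₁ p) (proj₂ p)) ⟩
      ∑ (peel start w) (λ p → ∑< (suc (length (proj₂ p))) (λ q → Φ (proj₁ p) (take q (proj₂ p)) (drop q (proj₂ p))))
    ≡⟨ ∑peel-split start w Φ ⟩
      ∑< (suc (length w)) (λ q → ∑ (peel start (take q w)) (λ p → Φ (proj₁ p) (proj₂ p) (drop q w)))
    ≡⟨ ∑<-cong (suc (length w)) (λ q → ∑-*ʳ (peel start (take q w)) (coeff (drop q w) j b)
                                          (λ p → if does (proj₁ p ≟Ñ a₀) then coeff (proj₂ p) i a else 0ℤ)) ⟩
      ∑< (suc (length w)) (λ p → coeff (take p w) (suc i) (a₀ V.∷ a) * coeff (drop p w) j b)
    ∎
    where
    open ≡-Reasoning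
    Φ : Ñ → List A → List A → ℤ
    Φ e u r = (if does (e ≟Ñ a₀) then coeff u i a else 0ℤ) * coeff r j b
    split : ∀ e u → (if does (e ≟Ñ a₀) then coeff u (i ℕ.+ j) (a V.++ b) else 0ℤ)
                    ≡ ∑< (suc (length u)) (λ q → Φ e (take q u) (drop q u))
    split e u with does (e ≟Ñ a₀)
    ... | true  = coeff-++ i j u a b
    ... | false = sym (trans (∑<-cong (suc (length u)) (λ q → ℤP.*-zeroˡ (coeff (drop q u) j b))) (∑<-zero (suc (length u))))

-- The state is the flag of the previous position: after a strict
-- position the current variable must stop.
module Flagged = Peeling {Ñ × Bool} {Bool} (λ strict _ → not strict) proj₂ proj₁ false

length-filterᵇ : ∀ {A : Set} (P : A → Bool) xs → ℤ.+ length (filterᵇ P xs) ≡ ∑ xs (λ x → 𝟙 (P x))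
length-filterᵇ P []       = refl
length-filterᵇ P (x ∷ xs) with P x
... | true  = cong (1ℤ +_) (length-filterᵇ P xs)
... | false = trans (length-filterᵇ P xs) (sym (ℤP.+-identityˡ _))

∑-𝟙∧ : ∀ {A : Set} (xs : List A) (b : Bool) (f : A → Bool) → ∑ xs (λ x → 𝟙 (b ∧ f x)) ≡ (if b then ∑ xs (λ x → 𝟙 (f x)) else 0ℤ)
∑-𝟙∧ xs true  f = refl
∑-𝟙∧ xs false f = ∑-zero xs

follows : ℕ × Bool → ℕ → Bool
follows (j , f) i = if f then j <ᵇ i else j ≤ᵇ i

admissibleAfter : ℕ × Bool → List Bool → List ℕ → Bool
admissibleAfter p fs []       = true
admissibleAfter p fs (i ∷ is) = follows p i ∧ admissible fs (i ∷ is)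

admissible-∷ : ∀ f fs i js → admissible (f ∷ fs) (i ∷ js) ≡ admissibleAfter (i , f) fs js
admissible-∷ f fs i []       = refl
admissible-∷ f fs i (j ∷ js) = refl

admissibleAfter-start : ∀ fs js → admissibleAfter (0 , false) fs js ≡ admissible fs js
admissibleAfter-start []       []       = refl
admissibleAfter-start (f ∷ fs) []       = refl
admissibleAfter-start fs       (i ∷ js) = refl

addAt : ∀ {k} → ℕ → Ñ → Vec Ñ k → Vec Ñ k
addAt i x v = tabulate (λ t → if i ≡ᵇ toℕ t then x ⊕ lookup v t else lookup v t)

monomialFrom : ∀ {k} → Vec Ñ k → List ℕ → List Ñ → Vec Ñ k
monomialFrom v (i ∷ js) (x ∷ xs) = monomialFrom (addAt i x v) js xs
monomialFrom v _        _        = v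

zeros : ∀ k → Vec Ñ k
zeros k = tabulate (λ _ → nat 0)

-- counts the index sequences that may continue after p and whose
-- monomial, added to v, is m
monoCount : List (Ñ × Bool) → (k : ℕ) → ℕ × Bool → Vec Ñ k → Vec Ñ k → ℤ
monoCount []              k p v m = 𝟙 (does (VP.≡-dec _≟Ñ_ v m))
monoCount ((x , f) ∷ es) k p v m =
  ∑< k (λ i → if follows p i then monoCount es k (i , f) (addAt i x v) m else 0ℤ)

count≡monoCount : ∀ k (m : Vec Ñ k) es p v →
  ∑ (seqs k (length es)) (λ js → 𝟙 (admissibleAfter p (map proj₂ es) js ∧ does (VP.≡-dec _≟Ñ_ (monomialFrom v js (map proj₁ es)) m)))
  ≡ monoCount es k p v m
count≡monoCount k m []              p v = ℤP.+-identityʳ _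
count≡monoCount k m ((x , f) ∷ es) p v =
  trans (∑-concatMap (λ i → map (i ∷_) (seqs k (length es))) (upTo k) _)
  (trans (∑-upTo k _)
  (∑<-cong k λ i →
    trans (∑-map (i ∷_) (seqs k (length es)) _)
    (trans (∑-cong (seqs k (length es)) (λ js → cong 𝟙 (reassociate i js)))
    (trans (∑-𝟙∧ (seqs k (length es)) (follows p i) _)
           (recurse (follows p i) i)))))
  where
  reassociate : ∀ i js →
    (admissibleAfter p (f ∷ map proj₂ es) (i ∷ js) ∧ does (VP.≡-dec _≟Ñ_ (monomialFrom (addAt i x v) js (map proj₁ es)) m))
    ≡ follows p i ∧ (admissibleAfter (i , f) (map proj₂ es) js ∧ does (VP.≡-dec _≟Ñ_ (monomialFrom (addAt i x v) js (map proj₁ es)) m))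
  reassociate i js =
    trans (BP.∧-assoc (follows p i) _ _)
          (cong (λ b → follows p i ∧ b ∧ _) (admissible-∷ f (map proj₂ es) i js))
  recurse : ∀ b i →
    (if b then ∑ (seqs k (length es)) (λ js → 𝟙 (admissibleAfter (i , f) (map proj₂ es) js
                                                 ∧ does (VP.≡-dec _≟Ñ_ (monomialFrom (addAt i x v) js (map proj₁ es)) m)))
          else 0ℤ)
    ≡ (if b then monoCount es k (i , f) (addAt i x v) m else 0ℤ)
  recurse true  i = count≡monoCount k m es (i , f) (addAt i x v)
  recurse false i = refl

vec-ext : ∀ {k} {u w : Vec Ñ k} → (∀ t → lookup u t ≡ lookup w t) → u ≡ w
vec-ext {u = u} {w} eq = trans (sym (VP.tabulate∘lookup u)) (trans (VP.tabulate-cong eq) (VP.tabulate∘lookup w))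

lookup-monomial-[] : ∀ k xs t → lookup (monomial k [] xs) t ≡ nat 0
lookup-monomial-[] k xs t = VP.lookup∘tabulate _ t

lookup-monomial-∷ : ∀ k i js x xs t →
  lookup (monomial k (i ∷ js) (x ∷ xs)) t
  ≡ (if i ≡ᵇ toℕ t then x ⊕ lookup (monomial k js xs) t else lookup (monomial k js xs) t)
lookup-monomial-∷ k i js x xs t
  rewrite VP.lookup∘tabulate (λ t' → foldr _⊕_ (nat 0) (map proj₂ (filterᵇ (λ p → proj₁ p ≡ᵇ toℕ t') (zip (i ∷ js) (x ∷ xs))))) t
        | VP.lookup∘tabulate (λ t' → foldr _⊕_ (nat 0) (map proj₂ (filterᵇ (λ p → proj₁ p ≡ᵇ toℕ t') (zip js xs)))) t
  with i ≡ᵇ toℕ t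
... | true  = refl
... | false = refl

lookup-monomialFrom : ∀ {k} (v : Vec Ñ k) js xs t →
  lookup (monomialFrom v js xs) t ≡ lookup v t ⊕ lookup (monomial k js xs) t
lookup-monomialFrom {k} v [] xs t =
  sym (trans (cong (lookup v t ⊕_) (lookup-monomial-[] k xs t)) (⊕-identityʳ _))
lookup-monomialFrom {k} v (i ∷ js) [] t =
  sym (trans (cong (lookup v t ⊕_) (VP.lookup∘tabulate _ t)) (⊕-identityʳ _))
lookup-monomialFrom {k} v (i ∷ js) (x ∷ xs) t
  rewrite lookup-monomialFrom (addAt i x v) js xs t | lookup-monomial-∷ k i js x xs t
        | VP.lookup∘tabulate (λ t' → if i ≡ᵇ toℕ t' then x ⊕ lookup v t' else lookup v t') t
  with i ≡ᵇ toℕ t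
... | true  = ⊕-xy∙z≈y∙xz x (lookup v t) _
... | false = refl

monomialFrom-zeros : ∀ k js xs → monomialFrom (zeros k) js xs ≡ monomial k js xs
monomialFrom-zeros k js xs = vec-ext λ t →
  trans (lookup-monomialFrom (zeros k) js xs t)
        (trans (cong (_⊕ lookup (monomial k js xs) t) (VP.lookup∘tabulate _ t)) (⊕-identityˡ _))

monoSum≡monoCount : ∀ es k m → monoSum es k m ≡ monoCount es k (0 , false) (zeros k) m
monoSum≡monoCount es k m =
  trans (length-filterᵇ _ (seqs k (length es)))
  (trans (∑-cong (seqs k (length es)) (λ js →
            cong₂ (λ a b → 𝟙 (a ∧ does (VP.≡-dec _≟Ñ_ b m)))
                  (sym (admissibleAfter-start (map proj₂ es) js))
                  (sym (monomialFrom-zeros k js (map proj₁ es)))))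
  (count≡monoCount k m es (0 , false) (zeros k)))

follows-suc-zero : ∀ j f → follows (suc j , f) 0 ≡ false
follows-suc-zero j true  = refl
follows-suc-zero j false = refl

follows-suc-suc : ∀ j f i → follows (suc j , f) (suc i) ≡ follows (j , f) i
follows-suc-suc j       true  i = refl
follows-suc-suc zero    false i = refl
follows-suc-suc (suc j) false i = refl

follows-zero-suc : ∀ f i → follows (0 , f) (suc i) ≡ true
follows-zero-suc true  i = refl
follows-zero-suc false i = refl

follows-zero-zero : ∀ f → follows (0 , f) 0 ≡ not f
follows-zero-zero true  = refl
follows-zero-zero false = refl

if-if-0 : ∀ (b d : Bool) (g : ℤ) → (if b then (if d then g else 0ℤ) else 0ℤ) ≡ (if d then (if b then g else 0ℤ) else 0ℤ)
if-if-0 true  d     g = refl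
if-if-0 false true  g = refl
if-if-0 false false g = refl

addAt-zero : ∀ {k} x h (t : Vec Ñ k) → addAt 0 x (h V.∷ t) ≡ (x ⊕ h) V.∷ t
addAt-zero x h t = cong ((x ⊕ h) V.∷_) (VP.tabulate∘lookup t)

-- Once the index has moved past the first variable, that variable is frozen.
monoCount-later : ∀ es k j f h (v : Vec Ñ k) e m →
  monoCount es (suc k) (suc j , f) (h V.∷ v) (e V.∷ m) ≡ (if does (h ≟Ñ e) then monoCount es k (j , f) v m else 0ℤ)
monoCount-later [] k j f h v e m with does (h ≟Ñ e)
... | true  = refl
... | false = refl
monoCount-later ((x , fl) ∷ es) k j f h v e m rewrite follows-suc-zero j f =
  trans (ℤP.+-identityˡ _)
  (trans (∑<-cong k (λ i →
            trans (cong (λ b → if b then monoCount es (suc k) (suc i , fl) (h V.∷ addAt i x v) (e V.∷ m) else 0ℤ)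
                        (follows-suc-suc j f i))
            (trans (cong (λ g → if follows (j , f) i then g else 0ℤ) (monoCount-later es k i fl h (addAt i x v) e m))
                   (if-if-0 (follows (j , f) i) (does (h ≟Ñ e)) _))))
         (∑<-if k (does (h ≟Ñ e)) _))

monoCount-first : ∀ es k f h (t : Vec Ñ k) e m →
  monoCount es (suc k) (0 , f) (h V.∷ t) (e V.∷ m)
  ≡ ∑ (Flagged.peel f es) (λ p → if does ((h ⊕ proj₁ p) ≟Ñ e) then monoCount (proj₂ p) k (0 , false) t m else 0ℤ)
monoCount-first [] k f h t e m rewrite ⊕-identityʳ h with does (h ≟Ñ e)
... | true  = sym (ℤP.+-identityʳ _)
... | false = refl
monoCount-first ((x , fl) ∷ es) k f h t e m =
  begin
    monoCount ((x , fl) ∷ es) (suc k) (0 , f) (h V.∷ t) (e V.∷ m)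
  ≡⟨ cong₂ _+_ stay leave ⟩
    Stay + Leave
  ≡⟨ ℤP.+-comm Stay Leave ⟩
    Leave + Stay
  ≡⟨ cong₂ _+_ (cong (λ q → if does (q ≟Ñ e) then monoCount ((x , fl) ∷ es) k (0 , false) t m else 0ℤ) (sym (⊕-identityʳ h)))
               (cong (λ g → if not f then g else 0ℤ)
                     (∑-cong (Flagged.peel fl es) (λ p → cong (λ q → if does (q ≟Ñ e) then monoCount (proj₂ p) k (0 , false) t m else 0ℤ)
                                                             (⊕-xy∙z≈y∙xz x h (proj₁ p))))) ⟩
    _
  ≡⟨ sym (Flagged.∑peel-∷ f (x , fl) es (λ q r → if does ((h ⊕ q) ≟Ñ e) then monoCount r k (0 , false) t m else 0ℤ)) ⟩
    ∑ (Flagged.peel f ((x , fl) ∷ es)) (λ p → if does ((h ⊕ proj₁ p) ≟Ñ e) then monoCount (proj₂ p) k (0 , false) t m else 0ℤ)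
  ∎
  where
  open ≡-Reasoning
  Stay = if not f then ∑ (Flagged.peel fl es) (λ p → if does (((x ⊕ h) ⊕ proj₁ p) ≟Ñ e) then monoCount (proj₂ p) k (0 , false) t m else 0ℤ) else 0ℤ
  Leave = if does (h ≟Ñ e) then monoCount ((x , fl) ∷ es) k (0 , false) t m else 0ℤ
  stay : (if follows (0 , f) 0 then monoCount es (suc k) (0 , fl) (addAt 0 x (h V.∷ t)) (e V.∷ m) else 0ℤ) ≡ Stay
  stay rewrite follows-zero-zero f | addAt-zero x h t with not f
  ... | true  = monoCount-first es k fl (x ⊕ h) t e m
  ... | false = refl
  leave : ∑< k (λ i → if follows (0 , f) (suc i) then monoCount es (suc k) (suc i , fl) (addAt (suc i) x (h V.∷ t)) (e V.∷ m) else 0ℤ) ≡ Leave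
  leave = trans (∑<-cong k (λ i → trans (cong (λ b → if b then monoCount es (suc k) (suc i , fl) (h V.∷ addAt i x t) (e V.∷ m) else 0ℤ)
                                              (follows-zero-suc f i))
                                       (monoCount-later es k i fl h (addAt i x t) e m)))
                (∑<-if k (does (h ≟Ñ e)) _)

monoCount≡coeff : ∀ k es m → monoCount es k (0 , false) (zeros k) m ≡ Flagged.coeff es k m
monoCount≡coeff zero    []       V.[]       = refl
monoCount≡coeff zero    (x ∷ es) V.[]       = refl
monoCount≡coeff (suc k) es       (e V.∷ m) =
  trans (monoCount-first es k false (nat 0) (zeros k) e m)
  (∑-cong (Flagged.peel false es) (λ p →
    trans (cong (λ q → if does (q ≟Ñ e) then monoCount (proj₂ p) k (0 , false) (zeros k) m else 0ℤ) (⊕-identityˡ (proj₁ p)))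
          (cong (λ g → if does (proj₁ p ≟Ñ e) then g else 0ℤ) (monoCount≡coeff k (proj₂ p) m))))

monoSum≡coeff : ∀ es k m → monoSum es k m ≡ Flagged.coeff es k m
monoSum≡coeff es k m = trans (monoSum≡monoCount es k m) (monoCount≡coeff k es m)

-- 𝒟₂ read directly on the word

canFollow : Maybe ℤ → ℤ → Bool
canFollow nothing  b = true
canFollow (just a) b = isNeg a ∨ (not (isNeg b) ∧ not (does (b ℤ.<? a)))

letterExp : ℤ → Ñ
letterExp -[1+ _ ] = ε
letterExp (ℤ.+ _)  = nat 1

module Letters = Peeling {ℤ} {Maybe ℤ} canFollow just letterExp nothing

endsBlock : ℤ → Word → Bool
endsBlock x []      = not (isNeg x)
endsBlock x (y ∷ _) = not (canFollow (just x) y)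

eWord : Word → List (Ñ × Bool)
eWord []      = []
eWord (x ∷ w) = (letterExp x , endsBlock x w) ∷ eWord w

Aligned : Maybe ℤ → Bool → Word → Set
Aligned s f []      = ⊤
Aligned s f (x ∷ _) = not f ≡ canFollow s x

∑peel-eWord : ∀ s f w → Aligned s f w → (Ψ : Ñ → List (Ñ × Bool) → ℤ) →
  ∑ (Letters.peel s w) (λ p → Ψ (proj₁ p) (eWord (proj₂ p))) ≡ ∑ (Flagged.peel f (eWord w)) (λ p → Ψ (proj₁ p) (proj₂ p))
∑peel-eWord s f []      _       Ψ = refl
∑peel-eWord s f (x ∷ w) aligned Ψ =
  trans (Letters.∑peel-∷ s x w (λ e u → Ψ e (eWord u)))
  (trans (cong (Ψ (nat 0) (eWord (x ∷ w)) +_)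
               (trans (cong (λ b → if b then _ else 0ℤ) (sym aligned)) (inner (not f))))
  (sym (Flagged.∑peel-∷ f (letterExp x , endsBlock x w) (eWord w) Ψ)))
  where
  aligned-next : ∀ w → Aligned (just x) (endsBlock x w) w
  aligned-next []      = tt
  aligned-next (y ∷ _) = BP.not-involutive _
  inner : ∀ b → (if b then ∑ (Letters.peel (just x) w) (λ p → Ψ (letterExp x ⊕ proj₁ p) (eWord (proj₂ p))) else 0ℤ)
              ≡ (if b then ∑ (Flagged.peel (endsBlock x w) (eWord w)) (λ p → Ψ (letterExp x ⊕ proj₁ p) (proj₂ p)) else 0ℤ)
  inner true  = ∑peel-eWord (just x) (endsBlock x w) w (aligned-next w) (λ e → Ψ (letterExp x ⊕ e))
  inner false = refl

coeff-eWord : ∀ k w m → Flagged.coeff (eWord w) k m ≡ Letters.coeff w k m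
coeff-eWord zero    []      V.[] = refl
coeff-eWord zero    (x ∷ w) V.[] = refl
coeff-eWord (suc k) w (e V.∷ m) =
  trans (sym (∑peel-eWord nothing false w (aligned-start w) (λ q r → if does (q ≟Ñ e) then Flagged.coeff r k m else 0ℤ)))
  (∑-cong (Letters.peel nothing w) (λ p → cong (λ g → if does (proj₁ p ≟Ñ e) then g else 0ℤ) (coeff-eWord k (proj₂ p) m)))
  where
  aligned-start : ∀ w → Aligned nothing false w
  aligned-start []      = tt
  aligned-start (x ∷ w) = refl

NotNeg : ℤ → Set
NotNeg x = isNeg x ≡ false

eData-++ : ∀ α β → eData (α ++ β) ≡ eData α ++ eData β
eData-++ []              β = refl
eData-++ (ε ∷ α)         β = cong (_ ∷_) (eData-++ α β)
eData-++ (nat zero ∷ α)  β = eData-++ α β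
eData-++ (nat (suc s) ∷ α) β =
  trans (cong (λ z → replicate s (nat 1 , false) ++ (nat 1 , true) ∷ z) (eData-++ α β))
        (sym (LP.++-assoc (replicate s (nat 1 , false)) _ _))

replicate-suc-++ : ∀ {A : Set} c (a : A) r → replicate (suc c) a ++ r ≡ replicate c a ++ a ∷ r
replicate-suc-++ zero    a r = refl
replicate-suc-++ (suc c) a r = cong (a ∷_) (replicate-suc-++ c a r)

eData-compAux : ∀ p w c → All NotNeg w →
  eData (map nat (compAux (ℤ.+ p) w (suc c))) ≡ replicate c (nat 1 , false) ++ eWord (ℤ.+ p ∷ w)
eData-compAux p []              c _ = refl
eData-compAux p (-[1+ n ] ∷ w)  c (() ∷ _)
eData-compAux p (ℤ.+ q ∷ w)     c (_ ∷ nn) with does (ℤ.+ q ℤ.<? ℤ.+ p)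
... | true  = cong (λ z → replicate c (nat 1 , false) ++ (nat 1 , true) ∷ z) (eData-compAux q w 0 nn)
... | false = trans (eData-compAux q w (suc c) nn) (replicate-suc-++ c (nat 1 , false) _)

eData-comp : ∀ r → All NotNeg r → eData (map nat (comp r)) ≡ eWord r
eData-comp []              _        = refl
eData-comp (-[1+ n ] ∷ r)  (() ∷ _)
eData-comp (ℤ.+ p ∷ r)     (_ ∷ nn) = eData-compAux p r 0 nn

eWord-++-neg : ∀ r n w → All NotNeg r → eWord (r ++ -[1+ n ] ∷ w) ≡ eWord r ++ eWord (-[1+ n ] ∷ w)
eWord-++-neg []                  n w _        = refl
eWord-++-neg (-[1+ m ] ∷ r)      n w (() ∷ _)
eWord-++-neg (ℤ.+ p ∷ [])        n w _        = refl
eWord-++-neg (ℤ.+ p ∷ y ∷ r)     n w (_ ∷ nn) = cong ((nat 1 , endsBlock (ℤ.+ p) (y ∷ r)) ∷_) (eWord-++-neg (y ∷ r) n w nn)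

eData-wcompAux : ∀ r w → All NotNeg r → eData (wcompAux r w) ≡ eWord (r ++ w)
eData-wcompAux r [] nn = trans (eData-comp r nn) (cong eWord (sym (LP.++-identityʳ r)))
eData-wcompAux r (-[1+ n ] ∷ w) nn =
  trans (eData-++ (map nat (comp r)) (ε ∷ wcompAux [] w))
  (trans (cong₂ _++_ (eData-comp r nn) (cong ((ε , false) ∷_) (eData-wcompAux [] w [])))
  (trans (cong (λ z → eWord r ++ (ε , z) ∷ eWord w) (open-after-neg w))
         (sym (eWord-++-neg r n w nn))))
  where
  open-after-neg : ∀ w → false ≡ endsBlock -[1+ n ] w
  open-after-neg []      = refl
  open-after-neg (y ∷ w) = refl
eData-wcompAux r (ℤ.+ p ∷ w) nn =
  trans (eData-wcompAux (r ++ ℤ.+ p ∷ []) w (AllP.++⁺ nn (refl ∷ [])))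
        (cong eWord (LP.++-assoc r (ℤ.+ p ∷ []) w))

eData-wcomp : ∀ w → eData (wcomp w) ≡ eWord w
eData-wcomp w = eData-wcompAux [] w []

𝒟₂≡coeff-eWord : ∀ w k m → 𝒟₂ w k m ≡ Flagged.coeff (eWord w) k m
𝒟₂≡coeff-eWord w k m = trans (cong (λ es → monoSum es k m) (eData-wcomp w)) (monoSum≡coeff (eWord w) k m)

𝒟₂≡coeff : ∀ w k m → 𝒟₂ w k m ≡ Letters.coeff w k m
𝒟₂≡coeff w k m = trans (𝒟₂≡coeff-eWord w k m) (coeff-eWord k w m)

-- Invariance under relabellings preserving signs and the order of positives

letterExp-cong : ∀ x y → isNeg x ≡ isNeg y → letterExp x ≡ letterExp y
letterExp-cong -[1+ _ ] -[1+ _ ] _ = refl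
letterExp-cong (ℤ.+ _)  (ℤ.+ _)  _ = refl
letterExp-cong -[1+ _ ] (ℤ.+ _)  ()
letterExp-cong (ℤ.+ _)  -[1+ _ ] ()

canFollow-cong : ∀ a b a' b' → isNeg a ≡ isNeg a' → isNeg b ≡ isNeg b' →
  (NotNeg a' → NotNeg b' → does (b ℤ.<? a) ≡ does (b' ℤ.<? a')) →
  canFollow (just a) b ≡ canFollow (just a') b'
canFollow-cong a b a' b' sa sb order rewrite sa | sb with isNeg a' | isNeg b'
... | true  | _     = refl
... | false | true  = refl
... | false | false = cong not (order refl refl)

eWord-map : ∀ {A : Set} (f g : A → ℤ) (Q : A → Set) (R : A → A → Set) (I : List A) →
  (∀ a → isNeg (f a) ≡ isNeg (g a)) →
  (∀ a b → Q a → Q b → R a b → NotNeg (g a) → NotNeg (g b) → does (f b ℤ.<? f a) ≡ does (g b ℤ.<? g a)) →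
  All Q I → Linked R I → eWord (map f I) ≡ eWord (map g I)
eWord-map f g Q R []      signs order _ _ = refl
eWord-map f g Q R (a ∷ []) signs order _ _ =
  cong₂ (λ x y → (x , y) ∷ []) (letterExp-cong (f a) (g a) (signs a)) (cong not (signs a))
eWord-map f g Q R (a ∷ b ∷ I) signs order (qa ∷ qb ∷ qs) (r ∷ rs) =
  cong₂ _∷_
    (cong₂ _,_ (letterExp-cong (f a) (g a) (signs a))
               (cong not (canFollow-cong (f a) (f b) (g a) (g b) (signs a) (signs b) (order a b qa qb r))))
    (eWord-map f g Q R (b ∷ I) signs order (qb ∷ qs) rs)

shiftLetter : ℕ → ℤ → ℤ
shiftLetter m x = if isNeg x then x ℤ.- ℤ.+ m else x + ℤ.+ m

isNeg-shiftLetter : ∀ m x → isNeg (shiftLetter m x) ≡ isNeg x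
isNeg-shiftLetter zero    -[1+ n ] = refl
isNeg-shiftLetter (suc m) -[1+ n ] = refl
isNeg-shiftLetter m       (ℤ.+ n)  = refl

linked-⊤ : ∀ {A : Set} (xs : List A) → Linked (λ _ _ → ⊤) xs
linked-⊤ []          = []
linked-⊤ (x ∷ [])    = [-]
linked-⊤ (x ∷ y ∷ xs) = tt ∷ linked-⊤ (y ∷ xs)

eWord-shift : ∀ m τ → eWord (shift m τ) ≡ eWord τ
eWord-shift m τ =
  trans (eWord-map (shiftLetter m) (λ x → x) (λ _ → ⊤) (λ _ _ → ⊤) τ (isNeg-shiftLetter m) order
                   (All.universal (λ _ → tt) τ) (linked-⊤ τ))
        (cong eWord (LP.map-id τ))
  where
  order : ∀ a b → ⊤ → ⊤ → ⊤ → NotNeg a → NotNeg b → does (shiftLetter m b ℤ.<? shiftLetter m a) ≡ does (b ℤ.<? a)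
  order -[1+ _ ] _        _ _ _ ()
  order (ℤ.+ _)  -[1+ _ ] _ _ _ _ ()
  order (ℤ.+ a)  (ℤ.+ b)  _ _ _ _ _ =
    does-⇔ (mk⇔ (λ lt → ℤ.+<+ (ℕP.+-cancelʳ-< m b a (ℤP.drop‿+<+ lt)))
                (λ lt → ℤ.+<+ (ℕP.+-monoˡ-< m (ℤP.drop‿+<+ lt))))
           (ℤ.+ (b ℕ.+ m) ℤ.<? ℤ.+ (a ℕ.+ m)) (ℤ.+ b ℤ.<? ℤ.+ a)

-- the letters counted by  rank I (i , a)
before : ℤ → ℕ → ℕ × ℤ → Bool
before a i q = (∣ proj₂ q ∣ <ᵇ ∣ a ∣) ∨ ((∣ proj₂ q ∣ ≡ᵇ ∣ a ∣) ∧ (proj₁ q <ᵇ i))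

filterᵇ-∷ : ∀ {A : Set} (P : A → Bool) x xs → filterᵇ P (x ∷ xs) ≡ (if P x then x ∷ filterᵇ P xs else filterᵇ P xs)
filterᵇ-∷ P x xs with P x
... | true  = refl
... | false = refl

length-filterᵇ-mono : ∀ {A : Set} (P Q : A → Bool) xs → (∀ x → T (P x) → T (Q x)) →
  length (filterᵇ P xs) ≤ length (filterᵇ Q xs)
length-filterᵇ-mono P Q [] h = ℕ.z≤n
length-filterᵇ-mono P Q (x ∷ xs) h rewrite filterᵇ-∷ P x xs | filterᵇ-∷ Q x xs with P x | Q x | h x
... | true  | true  | _ = ℕ.s≤s (length-filterᵇ-mono P Q xs h)
... | true  | false | k = ⊥-elim (k tt)
... | false | true  | _ = ℕP.m≤n⇒m≤1+n (length-filterᵇ-mono P Q xs h)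
... | false | false | _ = length-filterᵇ-mono P Q xs h

length-filterᵇ-strict : ∀ {A : Set} (P Q : A → Bool) xs y → y ∈ xs → T (Q y) → ¬ T (P y) → (∀ x → T (P x) → T (Q x)) →
  length (filterᵇ P xs) < length (filterᵇ Q xs)
length-filterᵇ-strict P Q (x ∷ xs) y (here refl) qy npy h rewrite filterᵇ-∷ P x xs | filterᵇ-∷ Q x xs with P x | Q x
... | true  | _     = ⊥-elim (npy tt)
... | false | true  = ℕ.s≤s (length-filterᵇ-mono P Q xs h)
... | false | false = ⊥-elim qy
length-filterᵇ-strict P Q (x ∷ xs) y (there y∈) qy npy h rewrite filterᵇ-∷ P x xs | filterᵇ-∷ Q x xs with P x | Q x | h x
... | true  | true  | _ = ℕ.s≤s (length-filterᵇ-strict P Q xs y y∈ qy npy h)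
... | true  | false | k = ⊥-elim (k tt)
... | false | true  | _ = ℕP.m≤n⇒m≤1+n (length-filterᵇ-strict P Q xs y y∈ qy npy h)
... | false | false | _ = length-filterᵇ-strict P Q xs y y∈ qy npy h

Before : ℤ → ℕ → ℕ × ℤ → Set
Before a i q = (∣ proj₂ q ∣ < ∣ a ∣) ⊎ ((∣ proj₂ q ∣ ≡ ∣ a ∣) × (proj₁ q < i))

before-sound : ∀ a i q → T (before a i q) → Before a i q
before-sound a i q t with Equivalence.to BP.T-∨ t
... | inj₁ lt = inj₁ (ℕP.<ᵇ⇒< _ _ lt)
... | inj₂ t₂ with Equivalence.to BP.T-∧ t₂
... | (e , lt) = inj₂ (ℕP.≡ᵇ⇒≡ _ _ e , ℕP.<ᵇ⇒< _ _ lt)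

before-complete : ∀ a i q → Before a i q → T (before a i q)
before-complete a i q (inj₁ lt)       = Equivalence.from BP.T-∨ (inj₁ (ℕP.<⇒<ᵇ lt))
before-complete a i q (inj₂ (e , lt)) = Equivalence.from BP.T-∨ (inj₂ (Equivalence.from BP.T-∧ (ℕP.≡⇒≡ᵇ _ _ e , ℕP.<⇒<ᵇ lt)))

before-mono-≤ : ∀ a b i j → ∣ a ∣ ≤ ∣ b ∣ → i < j → ∀ q → T (before a i q) → T (before b j q)
before-mono-≤ a b i j ab ij q t with before-sound a i q t
... | inj₁ lt = before-complete b j q (inj₁ (ℕP.<-≤-trans lt ab))
... | inj₂ (e , li) with ℕP.m≤n⇒m<n∨m≡n ab
... | inj₁ lt = before-complete b j q (inj₁ (subst (_< ∣ b ∣) (sym e) lt))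
... | inj₂ e' = before-complete b j q (inj₂ (trans e e' , ℕP.<-trans li ij))

before-mono-< : ∀ a b i j → ∣ b ∣ < ∣ a ∣ → ∀ q → T (before b j q) → T (before a i q)
before-mono-< a b i j ba q t with before-sound b j q t
... | inj₁ lt      = before-complete a i q (inj₁ (ℕP.<-trans lt ba))
... | inj₂ (e , _) = before-complete a i q (inj₁ (subst (_< ∣ a ∣) (sym e) ba))

before-irrefl : ∀ b j → ¬ T (before b j (j , b))
before-irrefl b j t with before-sound b j (j , b) t
... | inj₁ lt       = ℕP.<-irrefl refl lt
... | inj₂ (_ , lt) = ℕP.<-irrefl refl lt

rank-<⇔ : ∀ I i j a b → i < j → (j , b) ∈ I → (rank I (j , b) < rank I (i , a)) ⇔ (∣ b ∣ < ∣ a ∣)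
rank-<⇔ I i j a b ij mem = mk⇔ to from
  where
  from : ∣ b ∣ < ∣ a ∣ → rank I (j , b) < rank I (i , a)
  from ba = ℕ.s≤s (length-filterᵇ-strict (before b j) (before a i) I (j , b) mem
                     (before-complete a i (j , b) (inj₁ ba)) (before-irrefl b j) (before-mono-< a b i j ba))
  to : rank I (j , b) < rank I (i , a) → ∣ b ∣ < ∣ a ∣
  to lt with ∣ b ∣ ℕP.<? ∣ a ∣
  ... | yes ba  = ba
  ... | no ¬ba = ⊥-elim (ℕP.<⇒≱ lt (ℕ.s≤s (length-filterᵇ-mono (before a i) (before b j) I
                                                 (before-mono-≤ a b i j (ℕP.≮⇒≥ ¬ba) ij))))

map-proj₂-zip-upTo : ∀ (f : ℕ → ℕ) (w : Word) → map proj₂ (zip (applyUpTo f (length w)) w) ≡ w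
map-proj₂-zip-upTo f []      = refl
map-proj₂-zip-upTo f (x ∷ w) = cong (x ∷_) (map-proj₂-zip-upTo (f ∘ suc) w)

linked-zip-upTo : ∀ (f : ℕ → ℕ) (w : Word) → (∀ i → f i < f (suc i)) →
  Linked (λ p q → proj₁ p < proj₁ q) (zip (applyUpTo f (length w)) w)
linked-zip-upTo f []          h = []
linked-zip-upTo f (x ∷ [])    h = [-]
linked-zip-upTo f (x ∷ y ∷ w) h = h 0 ∷ linked-zip-upTo (f ∘ suc) (y ∷ w) (h ∘ suc)

eWord-st : ∀ w → eWord (st w) ≡ eWord w
eWord-st w =
  trans (eWord-map relabel proj₂ (_∈ I) (λ p q → proj₁ p < proj₁ q) I signs order
                   (All.tabulate (λ m → m)) (linked-zip-upTo (λ i → i) w (λ i → ℕP.n<1+n i)))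
        (cong eWord (map-proj₂-zip-upTo (λ i → i) w))
  where
  I = indexed w
  relabel : ℕ × ℤ → ℤ
  relabel p = signed (proj₂ p) (rank I p)
  signs : ∀ p → isNeg (relabel p) ≡ isNeg (proj₂ p)
  signs (i , -[1+ n ]) = refl
  signs (i , ℤ.+ n)    = refl
  order : ∀ p q → p ∈ I → q ∈ I → proj₁ p < proj₁ q → NotNeg (proj₂ p) → NotNeg (proj₂ q) →
          does (relabel q ℤ.<? relabel p) ≡ does (proj₂ q ℤ.<? proj₂ p)
  order (i , -[1+ _ ]) q _ _ _ ()
  order (i , ℤ.+ _) (j , -[1+ _ ]) _ _ _ _ ()
  order (i , ℤ.+ a) (j , ℤ.+ b) _ qm ij _ _ =
    does-⇔ (mk⇔ (λ lt → ℤ.+<+ (Equivalence.to   (rank-<⇔ I i j (ℤ.+ a) (ℤ.+ b) ij qm) (ℤP.drop‿+<+ lt)))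
                (λ lt → ℤ.+<+ (Equivalence.from (rank-<⇔ I i j (ℤ.+ a) (ℤ.+ b) ij qm) (ℤP.drop‿+<+ lt))))
           (ℤ.+ rank I (j , ℤ.+ b) ℤ.<? ℤ.+ rank I (i , ℤ.+ a)) (ℤ.+ b ℤ.<? ℤ.+ a)

𝒟₂-st : ∀ w k m → 𝒟₂ (st w) k m ≡ Letters.coeff w k m
𝒟₂-st w k m = trans (𝒟₂≡coeff-eWord (st w) k m) (trans (cong (λ es → Flagged.coeff es k m) (eWord-st w)) (coeff-eWord k w m))

𝒟₂-shift : ∀ m w k μ → 𝒟₂ w k μ ≡ Letters.coeff (shift m w) k μ
𝒟₂-shift m w k μ =
  trans (𝒟₂≡coeff-eWord w k μ) (trans (cong (λ es → Flagged.coeff es k μ) (sym (eWord-shift m w))) (coeff-eWord k (shift m w) μ))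

⟦_⟧ : LinComb Word → (Word → ℤ) → ℤ
⟦ L ⟧ Φ = ∑ L (λ p → proj₁ p * Φ (proj₂ p))

⟦⟧-cong : ∀ L {Φ Ψ} → (∀ w → Φ w ≡ Ψ w) → ⟦ L ⟧ Φ ≡ ⟦ L ⟧ Ψ
⟦⟧-cong L eq = ∑-cong L (λ p → cong (proj₁ p *_) (eq (proj₂ p)))

⟦⟧-+ : ∀ L Φ Ψ → ⟦ L ⟧ (λ w → Φ w + Ψ w) ≡ ⟦ L ⟧ Φ + ⟦ L ⟧ Ψ
⟦⟧-+ L Φ Ψ = trans (∑-cong L (λ p → ℤP.*-distribˡ-+ (proj₁ p) _ _)) (∑-+ L _ _)

⟦⟧-zero : ∀ L → ⟦ L ⟧ (λ _ → 0ℤ) ≡ 0ℤ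
⟦⟧-zero L = trans (∑-cong L (λ p → ℤP.*-zeroʳ (proj₁ p))) (∑-zero L)

⟦⟧-* : ∀ L c Φ → ⟦ L ⟧ (λ w → c * Φ w) ≡ c * ⟦ L ⟧ Φ
⟦⟧-* L c Φ = trans (∑-cong L (λ p → x∙yz≈y∙xz (proj₁ p) c (Φ (proj₂ p)))) (∑-*ˡ L c _)
  where open CommSemigroupProps ℤP.*-commutativeSemigroup using (x∙yz≈y∙xz)

⟦⟧-if : ∀ L (b : Bool) Φ → ⟦ L ⟧ (λ w → if b then Φ w else 0ℤ) ≡ (if b then ⟦ L ⟧ Φ else 0ℤ)
⟦⟧-if L true  Φ = refl
⟦⟧-if L false Φ = ⟦⟧-zero L

⟦⟧-++ : ∀ L L' Φ → ⟦ L ++ L' ⟧ Φ ≡ ⟦ L ⟧ Φ + ⟦ L' ⟧ Φ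
⟦⟧-++ L L' Φ = ∑-++ L L' _

⟦⟧-prepend : ∀ a L Φ → ⟦ prepend a L ⟧ Φ ≡ ⟦ L ⟧ (Φ ∘ (a ∷_))
⟦⟧-prepend a L Φ = ∑-map _ L _

⟦⟧-negateLC : ∀ L Φ → ⟦ negateLC L ⟧ Φ ≡ - ⟦ L ⟧ Φ
⟦⟧-negateLC L Φ =
  trans (∑-map _ L _) (trans (∑-cong L (λ p → sym (ℤP.neg-distribˡ-* (proj₁ p) _))) (∑-neg L _))

⟦[]⋆⟧ : ∀ w Φ → ⟦ [] ⋆ w ⟧ Φ ≡ Φ w
⟦[]⋆⟧ w Φ = trans (ℤP.+-identityʳ _) (ℤP.*-identityˡ _)

⟦⋆[]⟧ : ∀ w Φ → ⟦ w ⋆ [] ⟧ Φ ≡ Φ w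
⟦⋆[]⟧ []      Φ = ⟦[]⋆⟧ [] Φ
⟦⋆[]⟧ (x ∷ w) Φ = trans (ℤP.+-identityʳ _) (ℤP.*-identityˡ _)

⟦∷⋆∷⟧ : ∀ a u b v Φ → ⟦ (a ∷ u) ⋆ (b ∷ v) ⟧ Φ ≡
  ⟦ u ⋆ (b ∷ v) ⟧ (Φ ∘ (a ∷_)) + ⟦ (a ∷ u) ⋆ v ⟧ (Φ ∘ (b ∷_)) + 𝟙 (isNeg a ∧ isNeg b) * (- ⟦ u ⋆ v ⟧ (Φ ∘ (a ∷_)))
⟦∷⋆∷⟧ a u b v Φ =
  trans (⟦⟧-++ (prepend a (u ⋆ (b ∷ v))) _ Φ)
  (trans (cong₂ _+_ (⟦⟧-prepend a (u ⋆ (b ∷ v)) Φ)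
                    (trans (⟦⟧-++ (prepend b ((a ∷ u) ⋆ v)) _ Φ)
                           (cong₂ _+_ (⟦⟧-prepend b ((a ∷ u) ⋆ v) Φ) (merged (isNeg a ∧ isNeg b)))))
         (sym (ℤP.+-assoc (⟦ u ⋆ (b ∷ v) ⟧ (Φ ∘ (a ∷_))) (⟦ (a ∷ u) ⋆ v ⟧ (Φ ∘ (b ∷_))) _)))
  where
  merged : ∀ c → ⟦ if c then negateLC (prepend a (u ⋆ v)) else [] ⟧ Φ ≡ 𝟙 c * (- ⟦ u ⋆ v ⟧ (Φ ∘ (a ∷_)))
  merged true  = trans (⟦⟧-negateLC (prepend a (u ⋆ v)) Φ)
                        (trans (cong -_ (⟦⟧-prepend a (u ⋆ v) Φ)) (sym (ℤP.*-identityˡ _)))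
  merged false = sym (ℤP.*-zeroˡ (- ⟦ u ⋆ v ⟧ (Φ ∘ (a ∷_))))

-- Peeling commutes with the quasi-shuffle

peelSum : Maybe ℤ → Word → (Ñ → Word → ℤ) → ℤ
peelSum s w Φ = ∑ (Letters.peel s w) (λ p → Φ (proj₁ p) (proj₂ p))

peelSum-∷ : ∀ s x w Φ →
  peelSum s (x ∷ w) Φ ≡ Φ (nat 0) (x ∷ w) + 𝟙 (canFollow s x) * peelSum (just x) w (λ e r → Φ (letterExp x ⊕ e) r)
peelSum-∷ s x w Φ = trans (Letters.∑peel-∷ s x w Φ) (cong (Φ (nat 0) (x ∷ w) +_) (if-0≡𝟙* (canFollow s x) _))

peelSum-cong : ∀ s w {Φ Ψ : Ñ → Word → ℤ} → (∀ e r → Φ e r ≡ Ψ e r) → peelSum s w Φ ≡ peelSum s w Ψ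
peelSum-cong s w eq = ∑-cong (Letters.peel s w) (λ p → eq (proj₁ p) (proj₂ p))

peelSum-+ : ∀ s w (Φ Ψ : Ñ → Word → ℤ) → peelSum s w (λ e r → Φ e r + Ψ e r) ≡ peelSum s w Φ + peelSum s w Ψ
peelSum-+ s w Φ Ψ = ∑-+ (Letters.peel s w) _ _

peelSum-* : ∀ s w c (Φ : Ñ → Word → ℤ) → peelSum s w (λ e r → c * Φ e r) ≡ c * peelSum s w Φ
peelSum-* s w c Φ = ∑-*ˡ (Letters.peel s w) c _

⟦⟧-peelSum-∷ : ∀ s c X Φ →
  ⟦ X ⟧ (λ w → peelSum s (c ∷ w) Φ)
  ≡ ⟦ X ⟧ (λ w → Φ (nat 0) (c ∷ w)) + 𝟙 (canFollow s c) * ⟦ X ⟧ (λ w → peelSum (just c) w (λ e r → Φ (letterExp c ⊕ e) r))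
⟦⟧-peelSum-∷ s c X Φ =
  trans (⟦⟧-cong X (λ w → peelSum-∷ s c w Φ))
  (trans (⟦⟧-+ X _ _) (cong (⟦ X ⟧ (λ w → Φ (nat 0) (c ∷ w)) +_) (⟦⟧-* X (𝟙 (canFollow s c)) _)))

Separated : Word → Word → Set
Separated u v = All (λ x → All (λ y → NotNeg x → NotNeg y → x ℤ.< y) v) u

⋆-then-peel : Maybe ℤ → Word → Word → (Ñ → Word → ℤ) → ℤ
⋆-then-peel s u v Φ = ⟦ u ⋆ v ⟧ (λ w → peelSum s w Φ)

peel-then-⋆ : Maybe ℤ → Word → Word → (Ñ → Word → ℤ) → ℤ
peel-then-⋆ s u v Φ = peelSum s u (λ e₁ u' → peelSum s v (λ e₂ v' → ⟦ u' ⋆ v' ⟧ (Φ (e₁ ⊕ e₂))))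

-- When a variable may start with a and with b, the terms of a quasi-shuffle
-- it can start with are those starting with a and then able to take b,
-- plus those starting with b and then able to take a; for two negative
-- letters the merged term a•b is counted in both and subtracted once.
CanFollowIdentity : (sa sb ab ba nn : Bool) → Set
CanFollowIdentity sa sb ab ba nn = 𝟙 sa * 𝟙 sb ≡ 𝟙 sa * 𝟙 ab + 𝟙 sb * 𝟙 ba - 𝟙 nn * 𝟙 sa

canFollow-identity-positive : ∀ s a b → a ℤ.< b → NotNeg a → NotNeg b →
  CanFollowIdentity (canFollow s a) (canFollow s b) (canFollow (just a) b) (canFollow (just b) a) (isNeg a ∧ isNeg b)
canFollow-identity-positive s a b a<b na nb
  rewrite na | nb | dec-false (b ℤ.<? a) (ℤP.<-asym a<b) | dec-true (a ℤ.<? b) a<b = from s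
  where
  from : ∀ s → CanFollowIdentity (canFollow s a) (canFollow s b) true false false
  from nothing = refl
  from (just c) with isNeg c
  ... | true = refl
  ... | false rewrite na | nb with a ℤ.<? c
  ... | yes _ with does (b ℤ.<? c)
  ...   | true  = refl
  ...   | false = refl
  from (just c) | false | no a≮c with b ℤ.<? c
  ... | yes b<c = ⊥-elim (a≮c (ℤP.<-trans a<b b<c))
  ... | no _    = refl

canFollow-identity : ∀ s a b → (NotNeg a → NotNeg b → a ℤ.< b) →
  CanFollowIdentity (canFollow s a) (canFollow s b) (canFollow (just a) b) (canFollow (just b) a) (isNeg a ∧ isNeg b)
canFollow-identity s (ℤ.+ a) (ℤ.+ b) sep = canFollow-identity-positive s (ℤ.+ a) (ℤ.+ b) (sep refl refl) refl refl
canFollow-identity nothing -[1+ a ] -[1+ b ] sep = refl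
canFollow-identity nothing -[1+ a ] (ℤ.+ b)  sep = refl
canFollow-identity nothing (ℤ.+ a)  -[1+ b ] sep = refl
canFollow-identity (just c) -[1+ a ] -[1+ b ] sep with isNeg c
... | true  = refl
... | false = refl
canFollow-identity (just c) -[1+ a ] (ℤ.+ b) sep with isNeg c
... | true = refl
... | false with does (ℤ.+ b ℤ.<? c)
... | true  = refl
... | false = refl
canFollow-identity (just c) (ℤ.+ a) -[1+ b ] sep with isNeg c
... | true = refl
... | false with does (ℤ.+ a ℤ.<? c)
... | true  = refl
... | false = refl

recombine : ∀ P₁ P₂ P₃ Y₀ Y₁ Y₂ X R A B C D E →
  P₁ + P₂ + E * (- P₃) ≡ Y₀ →
  E * R ≡ E * X →
  A * B ≡ A * C + B * D - E * A →
  (P₁ + A * (Y₁ + C * X)) + (P₂ + B * (Y₂ + D * X)) + E * (- (P₃ + A * R)) ≡ Y₀ + B * Y₂ + A * (Y₁ + B * X)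
recombine P₁ P₂ P₃ Y₀ Y₁ Y₂ X R A B C D E p r c =
  trans (expand P₁ P₂ P₃ Y₁ Y₂ X R A B C D E)
  (trans (cong₂ (λ y z → y + A * Y₁ + B * Y₂ + (A * C + B * D) * X - A * z) p r)
  (trans (collect Y₀ Y₁ Y₂ X A B C D E)
  (trans (cong (λ z → Y₀ + A * Y₁ + B * Y₂ + z * X) (sym c))
         (regroup Y₀ Y₁ Y₂ X A B))))
  where
  expand : ∀ P₁ P₂ P₃ Y₁ Y₂ X R A B C D E →
    (P₁ + A * (Y₁ + C * X)) + (P₂ + B * (Y₂ + D * X)) + E * (- (P₃ + A * R))
    ≡ (P₁ + P₂ + E * (- P₃)) + A * Y₁ + B * Y₂ + (A * C + B * D) * X - A * (E * R)
  expand = solve-∀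
  collect : ∀ Y₀ Y₁ Y₂ X A B C D E →
    Y₀ + A * Y₁ + B * Y₂ + (A * C + B * D) * X - A * (E * X) ≡ Y₀ + A * Y₁ + B * Y₂ + (A * C + B * D - E * A) * X
  collect = solve-∀
  regroup : ∀ Y₀ Y₁ Y₂ X A B → Y₀ + A * Y₁ + B * Y₂ + (A * B) * X ≡ Y₀ + B * Y₂ + A * (Y₁ + B * X)
  regroup = solve-∀

⋆-then-peel-∷ : ∀ s a u b v Φ →
  ⋆-then-peel s (a ∷ u) (b ∷ v) Φ ≡
    (⟦ u ⋆ (b ∷ v) ⟧ (λ w → Φ (nat 0) (a ∷ w)) + 𝟙 (canFollow s a) * ⋆-then-peel (just a) u (b ∷ v) (λ e → Φ (letterExp a ⊕ e)))
    + (⟦ (a ∷ u) ⋆ v ⟧ (λ w → Φ (nat 0) (b ∷ w)) + 𝟙 (canFollow s b) * ⋆-then-peel (just b) (a ∷ u) v (λ e → Φ (letterExp b ⊕ e)))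
    + 𝟙 (isNeg a ∧ isNeg b) * (- (⟦ u ⋆ v ⟧ (λ w → Φ (nat 0) (a ∷ w)) + 𝟙 (canFollow s a) * ⋆-then-peel (just a) u v (λ e → Φ (letterExp a ⊕ e))))
⋆-then-peel-∷ s a u b v Φ =
  trans (⟦∷⋆∷⟧ a u b v (λ w → peelSum s w Φ))
  (cong₂ _+_ (cong₂ _+_ (⟦⟧-peelSum-∷ s a (u ⋆ (b ∷ v)) Φ) (⟦⟧-peelSum-∷ s b ((a ∷ u) ⋆ v) Φ))
             (cong (λ z → 𝟙 (isNeg a ∧ isNeg b) * (- z)) (⟦⟧-peelSum-∷ s a (u ⋆ v) Φ)))

peel-then-⋆-∷ : ∀ s a u b v Φ →
  peel-then-⋆ s (a ∷ u) (b ∷ v) Φ ≡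
    ⟦ (a ∷ u) ⋆ (b ∷ v) ⟧ (Φ (nat 0))
    + 𝟙 (canFollow s b) * peelSum (just b) v (λ e₂ v' → ⟦ (a ∷ u) ⋆ v' ⟧ (Φ (letterExp b ⊕ e₂)))
    + 𝟙 (canFollow s a) * (peelSum (just a) u (λ e₁ u' → ⟦ u' ⋆ (b ∷ v) ⟧ (Φ (letterExp a ⊕ e₁)))
                            + 𝟙 (canFollow s b) * peelSum (just a) u (λ e₁ u' → peelSum (just b) v (λ e₂ v' →
                                                     ⟦ u' ⋆ v' ⟧ (Φ (letterExp a ⊕ (e₁ ⊕ (letterExp b ⊕ e₂)))))))
peel-then-⋆-∷ s a u b v Φ =
  trans (peelSum-∷ s a u (λ e₁ u' → peelSum s (b ∷ v) (λ e₂ v' → ⟦ u' ⋆ v' ⟧ (Φ (e₁ ⊕ e₂)))))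
  (cong₂ _+_
    (trans (peelSum-∷ s b v (λ e₂ v' → ⟦ (a ∷ u) ⋆ v' ⟧ (Φ (nat 0 ⊕ e₂))))
           (cong (⟦ (a ∷ u) ⋆ (b ∷ v) ⟧ (Φ (nat 0)) +_)
                 (cong (𝟙 (canFollow s b) *_) (peelSum-cong (just b) v (λ e₂ v' →
                    cong (λ z → ⟦ (a ∷ u) ⋆ v' ⟧ (Φ z)) (⊕-identityˡ (letterExp b ⊕ e₂)))))))
    (cong (𝟙 (canFollow s a) *_)
      (trans (peelSum-cong (just a) u (λ e₁ u' → peelSum-∷ s b v (λ e₂ v' → ⟦ u' ⋆ v' ⟧ (Φ ((letterExp a ⊕ e₁) ⊕ e₂)))))
      (trans (peelSum-+ (just a) u _ _)
      (cong₂ _+_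
        (peelSum-cong (just a) u (λ e₁ u' → cong (λ z → ⟦ u' ⋆ (b ∷ v) ⟧ (Φ z)) (⊕-identityʳ (letterExp a ⊕ e₁))))
        (trans (peelSum-* (just a) u (𝟙 (canFollow s b)) _)
               (cong (𝟙 (canFollow s b) *_)
                     (peelSum-cong (just a) u (λ e₁ u' → peelSum-cong (just b) v (λ e₂ v' →
                        cong (λ z → ⟦ u' ⋆ v' ⟧ (Φ z)) (⊕-assoc (letterExp a) e₁ (letterExp b ⊕ e₂))))))))))))

peel-⋆-bounded : ∀ n u v → length u ℕ.+ length v ≤ n → Separated u v →
                 ∀ s Φ → ⋆-then-peel s u v Φ ≡ peel-then-⋆ s u v Φ
peel-⋆-bounded n [] v _ _ s Φ =
  trans (⟦[]⋆⟧ v (λ w → peelSum s w Φ))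
  (sym (trans (ℤP.+-identityʳ _)
              (peelSum-cong s v (λ e₂ v' → trans (⟦[]⋆⟧ v' (Φ (nat 0 ⊕ e₂))) (cong (λ z → Φ z v') (⊕-identityˡ e₂))))))
peel-⋆-bounded n (a ∷ u) [] _ _ s Φ =
  trans (⟦⋆[]⟧ (a ∷ u) (λ w → peelSum s w Φ))
  (sym (peelSum-cong s (a ∷ u) (λ e₁ u' →
     trans (ℤP.+-identityʳ _) (trans (⟦⋆[]⟧ u' (Φ (e₁ ⊕ nat 0))) (cong (λ z → Φ z u') (⊕-identityʳ e₁))))))
peel-⋆-bounded (suc n) (a ∷ u) (b ∷ v) (ℕ.s≤s size) ((a<b ∷ a<v) ∷ u<bv) s Φ =
  begin
    ⋆-then-peel s (a ∷ u) (b ∷ v) Φ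
  ≡⟨ ⋆-then-peel-∷ s a u b v Φ ⟩
    (P₁ + A * Q₁) + (P₂ + B * Q₂) + E * (- (P₃ + A * Q₃))
  ≡⟨ cong₂ (λ q₁ q₂ → (P₁ + A * q₁) + (P₂ + B * q₂) + E * (- (P₃ + A * Q₃))) a-first b-first ⟩
    (P₁ + A * (Y₁ + C * X)) + (P₂ + B * (Y₂ + D * X)) + E * (- (P₃ + A * Q₃))
  ≡⟨ recombine P₁ P₂ P₃ Y₀ Y₁ Y₂ X Q₃ A B C D E (sym (⟦∷⋆∷⟧ a u b v (Φ (nat 0)))) both-negative
               (canFollow-identity s a b a<b) ⟩
    Y₀ + B * Y₂ + A * (Y₁ + B * X)
  ≡⟨ sym (peel-then-⋆-∷ s a u b v Φ) ⟩
    peel-then-⋆ s (a ∷ u) (b ∷ v) Φ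
  ∎
  where
  open ≡-Reasoning
  ea = letterExp a
  eb = letterExp b
  A = 𝟙 (canFollow s a)
  B = 𝟙 (canFollow s b)
  C = 𝟙 (canFollow (just a) b)
  D = 𝟙 (canFollow (just b) a)
  E = 𝟙 (isNeg a ∧ isNeg b)
  Φa Φb : Ñ → Word → ℤ
  Φa e = Φ (ea ⊕ e)
  Φb e = Φ (eb ⊕ e)
  u<v : Separated u v
  u<v = All.map All.tail u<bv
  P₁ = ⟦ u ⋆ (b ∷ v) ⟧ (λ w → Φ (nat 0) (a ∷ w))
  P₂ = ⟦ (a ∷ u) ⋆ v ⟧ (λ w → Φ (nat 0) (b ∷ w))
  P₃ = ⟦ u ⋆ v ⟧ (λ w → Φ (nat 0) (a ∷ w))
  Q₁ = ⋆-then-peel (just a) u (b ∷ v) Φa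
  Q₂ = ⋆-then-peel (just b) (a ∷ u) v Φb
  Q₃ = ⋆-then-peel (just a) u v Φa
  Y₀ = ⟦ (a ∷ u) ⋆ (b ∷ v) ⟧ (Φ (nat 0))
  Y₁ = peelSum (just a) u (λ e₁ u' → ⟦ u' ⋆ (b ∷ v) ⟧ (Φ (ea ⊕ e₁)))
  Y₂ = peelSum (just b) v (λ e₂ v' → ⟦ (a ∷ u) ⋆ v' ⟧ (Φ (eb ⊕ e₂)))
  X = peelSum (just a) u (λ e₁ u' → peelSum (just b) v (λ e₂ v' → ⟦ u' ⋆ v' ⟧ (Φ (ea ⊕ (e₁ ⊕ (eb ⊕ e₂))))))
  a-first : Q₁ ≡ Y₁ + C * X
  a-first =
    trans (peel-⋆-bounded n u (b ∷ v) size u<bv (just a) Φa)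
    (trans (peelSum-cong (just a) u (λ e₁ u' → peelSum-∷ (just a) b v (λ e₂ v' → ⟦ u' ⋆ v' ⟧ (Φa (e₁ ⊕ e₂)))))
    (trans (peelSum-+ (just a) u _ _)
           (cong₂ _+_ (peelSum-cong (just a) u (λ e₁ u' → cong (λ z → ⟦ u' ⋆ (b ∷ v) ⟧ (Φ (ea ⊕ z))) (⊕-identityʳ e₁)))
                      (peelSum-* (just a) u C _))))
  b-first : Q₂ ≡ Y₂ + D * X
  b-first =
    trans (peel-⋆-bounded n (a ∷ u) v (subst (_≤ n) (ℕP.+-suc (length u) (length v)) size) (a<v ∷ u<v) (just b) Φb)
    (trans (peelSum-∷ (just b) a u (λ e₁ u' → peelSum (just b) v (λ e₂ v' → ⟦ u' ⋆ v' ⟧ (Φb (e₁ ⊕ e₂)))))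
    (cong₂ _+_ (peelSum-cong (just b) v (λ e₂ v' → cong (λ z → ⟦ (a ∷ u) ⋆ v' ⟧ (Φ (eb ⊕ z))) (⊕-identityˡ e₂)))
               (cong (D *_) (peelSum-cong (just a) u (λ e₁ u' → peelSum-cong (just b) v (λ e₂ v' →
                  cong (λ z → ⟦ u' ⋆ v' ⟧ (Φ z)) (swap ea eb e₁ e₂)))))))
    where
    swap : ∀ x y e₁ e₂ → y ⊕ ((x ⊕ e₁) ⊕ e₂) ≡ x ⊕ (e₁ ⊕ (y ⊕ e₂))
    swap x y e₁ e₂ = trans (⊕-x∙yz≈y∙xz y (x ⊕ e₁) e₂) (⊕-assoc x e₁ (y ⊕ e₂))
  -- Two negative letters: both variables' states are negative, and the
  -- extra ε of b is absorbed by the ε of a.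
  both-negative : E * Q₃ ≡ E * X
  both-negative = by-signs a b refl refl
    where
    by-signs : ∀ a₀ b₀ → a₀ ≡ a → b₀ ≡ b → 𝟙 (isNeg a₀ ∧ isNeg b₀) * Q₃ ≡ 𝟙 (isNeg a₀ ∧ isNeg b₀) * X
    by-signs (ℤ.+ _)  b₀       _ _ = trans (ℤP.*-zeroˡ Q₃) (sym (ℤP.*-zeroˡ X))
    by-signs -[1+ _ ] (ℤ.+ _)  _ _ = trans (ℤP.*-zeroˡ Q₃) (sym (ℤP.*-zeroˡ X))
    by-signs -[1+ _ ] -[1+ _ ] refl refl = cong (1ℤ *_)
      (trans (peel-⋆-bounded n u v (ℕP.≤-trans (ℕP.+-monoʳ-≤ (length u) (ℕP.n≤1+n (length v))) size) u<v (just a) Φa)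
        (peelSum-cong (just a) u (λ e₁ u' →
          trans (cong (λ t → ∑ t (λ p → ⟦ u' ⋆ proj₂ p ⟧ (Φ (ε ⊕ (e₁ ⊕ proj₁ p)))))
                      (Letters.peel-cong-state (just a) (just b) v (λ x → refl)))
                (peelSum-cong (just b) v (λ e₂ v' → cong (λ z → ⟦ u' ⋆ v' ⟧ (Φ z)) (ε-absorbs e₁ e₂))))))
      where
      ε-absorbs : ∀ e₁ e₂ → ε ⊕ (e₁ ⊕ e₂) ≡ ε ⊕ (e₁ ⊕ (ε ⊕ e₂))
      ε-absorbs e₁ e₂ = sym (trans (cong (ε ⊕_) (⊕-x∙yz≈y∙xz e₁ ε e₂)) (sym (⊕-assoc ε ε (e₁ ⊕ e₂))))

peel-⋆ : ∀ u v → Separated u v → ∀ s Φ → ⋆-then-peel s u v Φ ≡ peel-then-⋆ s u v Φ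
peel-⋆ u v = peel-⋆-bounded _ u v ℕP.≤-refl

-- 𝒟₂ is multiplicative

multiplicity : List Ñ → Ñ → ℤ
multiplicity C x = ∑ C (λ a → 𝟙 (does (x ≟Ñ a)))

∑-select : ∀ (C : List Ñ) x (H : Ñ → ℤ) → ∑ C (λ a → 𝟙 (does (x ≟Ñ a)) * H a) ≡ multiplicity C x * H x
∑-select C x H = trans (∑-cong C at-x) (∑-*ʳ C (H x) _)
  where
  at-x : ∀ a → 𝟙 (does (x ≟Ñ a)) * H a ≡ 𝟙 (does (x ≟Ñ a)) * H x
  at-x a with x ≟Ñ a
  ... | yes refl = refl
  ... | no _     = refl

does-nat≟nat : ∀ i j → does (nat i ≟Ñ nat j) ≡ (i ℕ.≡ᵇ j)
does-nat≟nat i j with i ℕ.≟ j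
... | yes refl = sym (Equivalence.to BP.T-≡ (ℕP.≡⇒≡ᵇ i i refl))
... | no i≢j with i ℕ.≡ᵇ j in eq
... | true  = ⊥-elim (i≢j (ℕP.≡ᵇ⇒≡ i j (subst T (sym eq) _)))
... | false = refl

∑<-𝟙-nat≟ : ∀ N i → i < N → ∑< N (λ j → 𝟙 (does (nat i ≟Ñ nat j))) ≡ 1ℤ
∑<-𝟙-nat≟ (suc N) zero    _ =
  cong (1ℤ +_) (trans (∑<-cong N (λ j → cong 𝟙 (does-nat≟nat 0 (suc j)))) (∑<-zero N))
∑<-𝟙-nat≟ (suc N) (suc i) (ℕ.s≤s i<N) =
  trans (ℤP.+-identityˡ _)
  (trans (∑<-cong N (λ j → cong 𝟙 (trans (does-nat≟nat (suc i) (suc j)) (sym (does-nat≟nat i j)))))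
         (∑<-𝟙-nat≟ N i i<N))

∑-map-nat-upTo : ∀ N x → ∑ (map nat (upTo N)) (λ a → 𝟙 (does (x ≟Ñ a))) ≡ ∑< N (λ j → 𝟙 (does (x ≟Ñ nat j)))
∑-map-nat-upTo N x = trans (∑-map nat (upTo N) _) (∑-upTo N _)

candidates-unique : ∀ x y e → x ⊕ y ≡ e → multiplicity (candidates e) x ≡ 1ℤ
candidates-unique ε             y       ε       _ = refl
candidates-unique (nat zero)    y       ε       _ = refl
candidates-unique (nat (suc i)) ε       ε       ()
candidates-unique (nat (suc i)) (nat j) ε       ()
candidates-unique ε             y       (nat n) _ =
  cong (1ℤ +_) (trans (∑-map-nat-upTo (suc n) ε) (∑<-zero (suc n)))
candidates-unique (nat i)       y       (nat n) eq =
  trans (ℤP.+-identityˡ _) (trans (∑-map-nat-upTo (suc n) (nat i)) (∑<-𝟙-nat≟ (suc n) i (ℕ.s≤s (summand-≤ y eq))))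
  where
  summand-≤ : ∀ y → nat i ⊕ y ≡ nat n → i ≤ n
  summand-≤ ε       eq = ε-summand-≤ i eq
    where
    ε-summand-≤ : ∀ i → nat i ⊕ ε ≡ nat n → i ≤ n
    ε-summand-≤ (suc _) refl = ℕP.≤-refl
  summand-≤ (nat j) eq = subst (i ≤_) (nat-injective (trans (sym (nat-⊕-nat i j)) eq)) (ℕP.m≤m+n i j)
    where
    nat-injective : ∀ {a b} → nat a ≡ nat b → a ≡ b
    nat-injective refl = refl

∑splits-∷ : ∀ {k} e₁ e₂ e (m : Vec Ñ k) (f g : Vec Ñ k → ℤ) →
  ∑ (splits (e V.∷ m)) (λ ab → (𝟙 (does (e₁ ≟Ñ V.head (proj₁ ab))) * f (V.tail (proj₁ ab)))
                             * (𝟙 (does (e₂ ≟Ñ V.head (proj₂ ab))) * g (V.tail (proj₂ ab))))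
  ≡ (if does ((e₁ ⊕ e₂) ≟Ñ e) then ∑ (splits m) (λ ab → f (proj₁ ab) * g (proj₂ ab)) else 0ℤ)
∑splits-∷ {k} e₁ e₂ e m f g =
  begin
    ∑ (splits (e V.∷ m)) h
  ≡⟨ ∑-concatMap (λ a → concatMap (λ b → if does ((a ⊕ b) ≟Ñ e) then map (extend a b) (splits m) else []) C) C h ⟩
    ∑ C (λ a → ∑ (concatMap (λ b → if does ((a ⊕ b) ≟Ñ e) then map (extend a b) (splits m) else []) C) h)
  ≡⟨ ∑-cong C (λ a → trans (∑-concatMap (λ b → if does ((a ⊕ b) ≟Ñ e) then map (extend a b) (splits m) else []) C h)
                           (∑-cong C (λ b → heads a b (does ((a ⊕ b) ≟Ñ e))))) ⟩
    ∑ C (λ a → ∑ C (λ b → 𝟙 (does (e₁ ≟Ñ a)) * (𝟙 (does (e₂ ≟Ñ b)) * W a b)))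
  ≡⟨ ∑-cong C (λ a → trans (∑-*ˡ C (𝟙 (does (e₁ ≟Ñ a))) (λ b → 𝟙 (does (e₂ ≟Ñ b)) * W a b))
                           (cong (𝟙 (does (e₁ ≟Ñ a)) *_) (∑-select C e₂ (W a)))) ⟩
    ∑ C (λ a → 𝟙 (does (e₁ ≟Ñ a)) * (multiplicity C e₂ * W a e₂))
  ≡⟨ ∑-select C e₁ (λ a → multiplicity C e₂ * W a e₂) ⟩
    multiplicity C e₁ * (multiplicity C e₂ * W e₁ e₂)
  ≡⟨ once ((e₁ ⊕ e₂) ≟Ñ e) ⟩
    W e₁ e₂
  ∎
  where
  open ≡-Reasoning
  C = candidates e
  h : Vec Ñ (suc k) × Vec Ñ (suc k) → ℤ
  h ab = (𝟙 (does (e₁ ≟Ñ V.head (proj₁ ab))) * f (V.tail (proj₁ ab))) * (𝟙 (does (e₂ ≟Ñ V.head (proj₂ ab))) * g (V.tail (proj₂ ab)))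
  extend : Ñ → Ñ → Vec Ñ k × Vec Ñ k → Vec Ñ (suc k) × Vec Ñ (suc k)
  extend a b (as , bs) = (a V.∷ as , b V.∷ bs)
  Z = ∑ (splits m) (λ ab → f (proj₁ ab) * g (proj₂ ab))
  W : Ñ → Ñ → ℤ
  W a b = if does ((a ⊕ b) ≟Ñ e) then Z else 0ℤ
  reassoc : ∀ x y u v → (x * u) * (y * v) ≡ x * (y * (u * v))
  reassoc = solve-∀
  heads : ∀ a b c → ∑ (if c then map (extend a b) (splits m) else []) h ≡ 𝟙 (does (e₁ ≟Ñ a)) * (𝟙 (does (e₂ ≟Ñ b)) * (if c then Z else 0ℤ))
  heads a b true =
    trans (∑-map (extend a b) (splits m) h)
    (trans (∑-cong (splits m) (λ ab → reassoc (𝟙 (does (e₁ ≟Ñ a))) (𝟙 (does (e₂ ≟Ñ b))) (f (proj₁ ab)) (g (proj₂ ab))))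
    (trans (∑-*ˡ (splits m) (𝟙 (does (e₁ ≟Ñ a))) (λ ab → 𝟙 (does (e₂ ≟Ñ b)) * (f (proj₁ ab) * g (proj₂ ab))))
           (cong (𝟙 (does (e₁ ≟Ñ a)) *_) (∑-*ˡ (splits m) (𝟙 (does (e₂ ≟Ñ b))) (λ ab → f (proj₁ ab) * g (proj₂ ab))))))
  heads a b false = sym (trans (cong (𝟙 (does (e₁ ≟Ñ a)) *_) (ℤP.*-zeroʳ (𝟙 (does (e₂ ≟Ñ b))))) (ℤP.*-zeroʳ (𝟙 (does (e₁ ≟Ñ a)))))
  once : ∀ d → multiplicity C e₁ * (multiplicity C e₂ * (if does d then Z else 0ℤ)) ≡ (if does d then Z else 0ℤ)
  once (yes eq) rewrite candidates-unique e₁ e₂ e eq | candidates-unique e₂ e₁ e (trans (⊕-comm e₂ e₁) eq) =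
    trans (ℤP.*-identityˡ _) (ℤP.*-identityˡ _)
  once (no _) = trans (cong (multiplicity C e₁ *_) (ℤP.*-zeroʳ (multiplicity C e₂))) (ℤP.*-zeroʳ (multiplicity C e₁))

∑-*-∑ : ∀ {X Y Z : Set} (zs : List Z) (xs : List X) (ys : List Y) (φ : X → Z → ℤ) (ψ : Y → Z → ℤ) →
  ∑ zs (λ z → ∑ xs (λ x → φ x z) * ∑ ys (λ y → ψ y z)) ≡ ∑ xs (λ x → ∑ ys (λ y → ∑ zs (λ z → φ x z * ψ y z)))
∑-*-∑ zs xs ys φ ψ =
  trans (∑-cong zs (λ z → trans (sym (∑-*ʳ xs (∑ ys (λ y → ψ y z)) (λ x → φ x z)))
                                (∑-cong xs (λ x → sym (∑-*ˡ ys (φ x z) (λ y → ψ y z))))))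
  (trans (∑-comm zs xs (λ z x → ∑ ys (λ y → φ x z * ψ y z)))
         (∑-cong xs (λ x → ∑-comm zs ys (λ z y → φ x z * ψ y z))))

*ₛ-coeff-suc : ∀ k u v e (m : Vec Ñ k) →
  (Letters.coeff u *ₛ Letters.coeff v) (suc k) (e V.∷ m)
  ≡ peelSum nothing u (λ e₁ u' → peelSum nothing v (λ e₂ v' →
      if does ((e₁ ⊕ e₂) ≟Ñ e) then (Letters.coeff u' *ₛ Letters.coeff v') k m else 0ℤ))
*ₛ-coeff-suc k u v e m =
  trans (∑-cong (splits (e V.∷ m)) (λ ab → cong₂ _*_ (Letters.coeff-suc u k (proj₁ ab)) (Letters.coeff-suc v k (proj₂ ab))))
  (trans (∑-*-∑ (splits (e V.∷ m)) (Letters.peel nothing u) (Letters.peel nothing v)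
            (λ p ab → 𝟙 (does (proj₁ p ≟Ñ V.head (proj₁ ab))) * Letters.coeff (proj₂ p) k (V.tail (proj₁ ab)))
            (λ q ab → 𝟙 (does (proj₁ q ≟Ñ V.head (proj₂ ab))) * Letters.coeff (proj₂ q) k (V.tail (proj₂ ab))))
  (∑-cong (Letters.peel nothing u) (λ p → ∑-cong (Letters.peel nothing v) (λ q →
     ∑splits-∷ (proj₁ p) (proj₁ q) e m (Letters.coeff (proj₂ p) k) (Letters.coeff (proj₂ q) k)))))

coeff-⋆ : ∀ k u v → Separated u v → ∀ (m : Vec Ñ k) →
  ⟦ u ⋆ v ⟧ (λ w → Letters.coeff w k m) ≡ (Letters.coeff u *ₛ Letters.coeff v) k m
coeff-⋆ zero [] v _ V.[] =
  trans (⟦[]⋆⟧ v (λ w → Letters.coeff w zero V.[])) (sym (trans (ℤP.+-identityʳ _) (ℤP.*-identityˡ _)))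
coeff-⋆ zero (a ∷ u) [] _ V.[] = ⟦⋆[]⟧ (a ∷ u) (λ w → Letters.coeff w zero V.[])
coeff-⋆ zero (a ∷ u) (b ∷ v) _ V.[] =
  trans (⟦∷⋆∷⟧ a u b v (λ w → Letters.coeff w zero V.[]))
  (cong₂ _+_ (cong₂ _+_ (⟦⟧-zero (u ⋆ (b ∷ v))) (⟦⟧-zero ((a ∷ u) ⋆ v)))
             (trans (cong (λ z → 𝟙 (isNeg a ∧ isNeg b) * (- z)) (⟦⟧-zero (u ⋆ v))) (ℤP.*-zeroʳ (𝟙 (isNeg a ∧ isNeg b)))))
coeff-⋆ (suc k) u v u<v (e V.∷ m) =
  trans (peel-⋆ u v u<v nothing (λ e' w' → if does (e' ≟Ñ e) then Letters.coeff w' k m else 0ℤ))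
  (trans (∑-congAll (All.map (λ {p} u'<v → ∑-congAll (All.map (λ {q} u'<v' →
            trans (⟦⟧-if (proj₂ p ⋆ proj₂ q) (does ((proj₁ p ⊕ proj₁ q) ≟Ñ e)) (λ w → Letters.coeff w k m))
                  (cong (λ z → if does ((proj₁ p ⊕ proj₁ q) ≟Ñ e) then z else 0ℤ) (coeff-⋆ k (proj₂ p) (proj₂ q) u'<v' m)))
            (Letters.peel-All (Separated (proj₂ p)) (All.map All.tail) nothing v u'<v)))
          (Letters.peel-All (λ w → Separated w v) All.tail nothing u u<v)))
  (sym (*ₛ-coeff-suc k u v e m)))

linS≡∑ : ∀ {A : Set} (f : A → Series) L k m → linS f L k m ≡ ∑ L (λ p → proj₁ p * f (proj₂ p) k m)
linS≡∑ f []            k m = refl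
linS≡∑ f ((c , a) ∷ L) k m = cong (c * f a k m +_) (linS≡∑ f L k m)

linS-𝒟₂-stLin : ∀ L k m → linS 𝒟₂ (stLin L) k m ≡ ⟦ L ⟧ (λ w → Letters.coeff w k m)
linS-𝒟₂-stLin []            k m = refl
linS-𝒟₂-stLin ((c , w) ∷ L) k m = cong₂ _+_ (cong (c *_) (𝒟₂-st w k m)) (linS-𝒟₂-stLin L k m)

*ₛ-cong : ∀ {f f' g g'} → f ≈ f' → g ≈ g' → (f *ₛ g) ≈ (f' *ₛ g')
*ₛ-cong f≈f' g≈g' k m = ∑-cong (splits m) (λ ab → cong₂ _*_ (f≈f' k (proj₁ ab)) (g≈g' k (proj₂ ab)))

signedPerm-bounds : ∀ m σ → IsSignedPerm m σ → ∀ {x} → x ∈ σ → (1 ≤ ∣ x ∣) × (∣ x ∣ ≤ m)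
signedPerm-bounds m σ p {x} x∈σ with MP.∈-map⁻ suc (PermP.∈-resp-↭ p (MP.∈-map⁺ ∣_∣ x∈σ))
... | j , j∈ , eq rewrite eq = ℕ.s≤s ℕ.z≤n , MP.∈-upTo⁻ j∈

signedPerm-length : ∀ m σ → IsSignedPerm m σ → length σ ≡ m
signedPerm-length m σ p =
  trans (sym (LP.length-map ∣_∣ σ)) (trans (PermP.↭-length p) (trans (LP.length-map suc (upTo m)) (LP.length-upTo m)))

separated-shift : ∀ m n σ τ → IsSignedPerm m σ → IsSignedPerm n τ → Separated σ (shift (length σ) τ)
separated-shift m n σ τ pσ pτ =
  All.tabulate (λ {x} x∈σ → All.tabulate (λ {y} y∈ →
    below x y (signedPerm-bounds m σ pσ x∈σ) (MP.∈-map⁻ (shiftLetter (length σ)) y∈)))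
  where
  below : ∀ x y → (1 ≤ ∣ x ∣) × (∣ x ∣ ≤ m) → ∃ (λ y₀ → (y₀ ∈ τ) × (y ≡ shiftLetter (length σ) y₀)) →
          NotNeg x → NotNeg y → x ℤ.< y
  below -[1+ _ ] y _ _ ()
  below (ℤ.+ i) y _ (-[1+ j ] , _ , refl) _ ny with trans (sym (isNeg-shiftLetter (length σ) -[1+ j ])) ny
  ... | ()
  below (ℤ.+ i) y (_ , i≤m) (ℤ.+ j , j∈τ , refl) _ _ =
    ℤ.+<+ (ℕP.≤-<-trans (subst (i ≤_) (sym (signedPerm-length m σ pσ)) i≤m)
                        (ℕP.m<n+m (length σ) (proj₁ (signedPerm-bounds n τ pτ j∈τ))))

product : ∀ m n (σ τ : Word) → IsSignedPerm m σ → IsSignedPerm n τ → linS 𝒟₂ (σ ⋆̄ τ) ≈ (𝒟₂ σ *ₛ 𝒟₂ τ)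
product m n σ τ pσ pτ k μ =
  trans (linS-𝒟₂-stLin (σ ⋆ shift (length σ) τ) k μ)
  (trans (coeff-⋆ k σ (shift (length σ) τ) (separated-shift m n σ τ pσ pτ) μ)
         (*ₛ-cong (λ k a → sym (𝒟₂≡coeff σ k a)) (λ k a → sym (𝒟₂-shift (length σ) τ k a)) k μ))

-- Unit, counit and coproduct

unit : 𝒟₂ ı ≈ 1ₛ
unit k m with VP.≡-dec _≟Ñ_ m (zeros k) | VP.≡-dec _≟Ñ_ (zeros k) m
... | yes _   | yes _   = refl
... | no _    | no _    = refl
... | yes m≡0 | no 0≢m = ⊥-elim (0≢m (sym m≡0))
... | no m≢0  | yes 0≡m = ⊥-elim (m≢0 (sym 0≡m))

strictly : RComp → List (Ñ × Bool)
strictly = map (λ a → (a , true))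

M≡coeff : ∀ α k m → M α k m ≡ Flagged.coeff (strictly α) k m
M≡coeff α = monoSum≡coeff (strictly α)

-- The constant term of a series is its coefficient for k = 0 variables.
evalM-constant : ∀ L → evalM L 0 V.[] ≡ εR L
evalM-constant [] = refl
evalM-constant ((c , []) ∷ L) =
  cong₂ _+_ (trans (cong (c *_) (M≡coeff [] 0 V.[])) (ℤP.*-identityʳ c)) (evalM-constant L)
evalM-constant ((c , a ∷ α) ∷ L) =
  trans (cong₂ _+_ (trans (cong (c *_) (M≡coeff (a ∷ α) 0 V.[])) (ℤP.*-zeroʳ c)) (evalM-constant L)) (ℤP.+-identityˡ _)

counit : ∀ n (σ : Word) → IsSignedPerm n σ → (L : LinComb RComp) →
         All (λ p → IsRComp (proj₂ p)) L → 𝒟₂ σ ≈ evalM L → εR L ≡ εH σ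
counit n σ _ L _ 𝒟₂σ≈L =
  trans (sym (evalM-constant L)) (trans (sym (𝒟₂σ≈L 0 V.[])) (trans (𝒟₂≡coeff σ 0 V.[]) (constant-term σ)))
  where
  constant-term : ∀ σ → Letters.coeff σ 0 V.[] ≡ εH σ
  constant-term []      = refl
  constant-term (x ∷ σ) = refl

sum₂-map : ∀ {A : Set} (F : A → Series₂) xs k a b → sum₂ (map F xs) k a b ≡ ∑ xs (λ x → F x k a b)
sum₂-map F []       k a b = refl
sum₂-map F (x ∷ xs) k a b = cong (F x k a b +_) (sum₂-map F xs k a b)

-- f ⊗ g is read off f·g in the variables x₁..x_k, y₁..y_k concatenated.
ΔRM≡M-++ : ∀ α k (a b : Vec Ñ k) → ΔRM α k a b ≡ M α (k ℕ.+ k) (a V.++ b)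
ΔRM≡M-++ α k a b =
  trans (sum₂-map (λ i → M (take i α) ⊗ M (drop i α)) (upTo (suc (length α))) k a b)
  (trans (∑-upTo (suc (length α)) (λ i → M (take i α) k a * M (drop i α) k b))
  (trans (∑<-cong (suc (length α)) (λ i →
            cong₂ _*_ (trans (M≡coeff (take i α) k a) (cong (λ es → Flagged.coeff es k a) (sym (LP.take-map i α))))
                      (trans (M≡coeff (drop i α) k b) (cong (λ es → Flagged.coeff es k b) (sym (LP.drop-map i α))))))
  (trans (cong (λ n → ∑< (suc n) (λ i → Flagged.coeff (take i (strictly α)) k a * Flagged.coeff (drop i (strictly α)) k b))
               (sym (LP.length-map _ α)))
  (trans (sym (Flagged.coeff-++ k k (strictly α) a b)) (sym (M≡coeff α (k ℕ.+ k) (a V.++ b)))))))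

ΔR≡evalM-++ : ∀ L k (a b : Vec Ñ k) → ΔR L k a b ≡ evalM L (k ℕ.+ k) (a V.++ b)
ΔR≡evalM-++ []            k a b = refl
ΔR≡evalM-++ ((c , α) ∷ L) k a b = cong₂ _+_ (cong (c *_) (ΔRM≡M-++ α k a b)) (ΔR≡evalM-++ L k a b)

coproduct : ∀ n (σ : Word) → IsSignedPerm n σ → (L : LinComb RComp) →
            All (λ p → IsRComp (proj₂ p)) L → 𝒟₂ σ ≈ evalM L → ΔR L ≈₂ 𝒟₂⊗𝒟₂Δ σ
coproduct n σ _ L _ 𝒟₂σ≈L k a b =
  begin
    ΔR L k a b
  ≡⟨ ΔR≡evalM-++ L k a b ⟩
    evalM L (k ℕ.+ k) (a V.++ b)
  ≡⟨ sym (trans (sym (𝒟₂≡coeff σ (k ℕ.+ k) (a V.++ b))) (𝒟₂σ≈L (k ℕ.+ k) (a V.++ b))) ⟩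
    Letters.coeff σ (k ℕ.+ k) (a V.++ b)
  ≡⟨ Letters.coeff-++ k k σ a b ⟩
    ∑< (suc (length σ)) (λ i → Letters.coeff (take i σ) k a * Letters.coeff (drop i σ) k b)
  ≡⟨ ∑<-cong (suc (length σ)) (λ i → sym (cong₂ _*_ (𝒟₂-st (take i σ) k a) (𝒟₂-st (drop i σ) k b))) ⟩
    ∑< (suc (length σ)) (λ i → 𝒟₂ (st (take i σ)) k a * 𝒟₂ (st (drop i σ)) k b)
  ≡⟨ sym (trans (sum₂-map (λ p → 𝒟₂ (proj₁ p) ⊗ 𝒟₂ (proj₂ p)) (ΔH σ) k a b)
                (trans (∑-map (λ p → (st (take p σ) , st (drop p σ))) (upTo (suc (length σ))) (λ p → 𝒟₂ (proj₁ p) k a * 𝒟₂ (proj₂ p) k b))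
                       (∑-upTo (suc (length σ)) (λ i → 𝒟₂ (st (take i σ)) k a * 𝒟₂ (st (drop i σ)) k b)))) ⟩
    𝒟₂⊗𝒟₂Δ σ k a b
  ∎
  where open ≡-Reasoning

-- 𝒟₂ lands in RQSym

-- x₁ either skips a strict word or absorbs exactly its first letter.
coeff-strictly-suc : ∀ a α k e (m : Vec Ñ k) →
  Flagged.coeff (strictly (a ∷ α)) (suc k) (e V.∷ m)
  ≡ 𝟙 (does (nat 0 ≟Ñ e)) * Flagged.coeff (strictly (a ∷ α)) k m + 𝟙 (does (a ≟Ñ e)) * Flagged.coeff (strictly α) k m
coeff-strictly-suc a α k e m = cong₂ _+_ (if-0≡𝟙* (does (nat 0 ≟Ñ e)) _) (only-first α refl)
  where
  first-letter : (if does ((a ⊕ nat 0) ≟Ñ e) then Flagged.coeff (strictly α) k m else 0ℤ) + 0ℤ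
                 ≡ 𝟙 (does (a ≟Ñ e)) * Flagged.coeff (strictly α) k m
  first-letter = trans (ℤP.+-identityʳ _)
    (trans (cong (λ z → if does (z ≟Ñ e) then Flagged.coeff (strictly α) k m else 0ℤ) (⊕-identityʳ a))
           (if-0≡𝟙* (does (a ≟Ñ e)) _))
  only-first : ∀ β → β ≡ α →
    ∑ (map (λ p → (a ⊕ proj₁ p , proj₂ p)) (Flagged.peel true (strictly β)))
      (λ p → if does (proj₁ p ≟Ñ e) then Flagged.coeff (proj₂ p) k m else 0ℤ)
    ≡ 𝟙 (does (a ≟Ñ e)) * Flagged.coeff (strictly α) k m
  only-first []      refl = first-letter
  only-first (_ ∷ _) refl = first-letter

-- Each variable used absorbs the first remaining position together with a
-- peel of what follows; that total exponent is the next part of α.  The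
-- natural number is fuel bounding the length.
mExpansion : ℕ → List (Ñ × Bool) → LinComb RComp
mExpansion _       []       = (1ℤ , []) ∷ []
mExpansion zero    (_ ∷ _)  = []
mExpansion (suc n) (x ∷ es) =
  concatMap (λ p → map (λ q → (proj₁ q , (proj₁ x ⊕ proj₁ p) ∷ proj₂ q)) (mExpansion n (proj₂ p)))
            (Flagged.peel (proj₂ x) es)

evalᶜ : LinComb RComp → (k : ℕ) → Vec Ñ k → ℤ
evalᶜ L k m = ∑ L (λ p → proj₁ p * Flagged.coeff (strictly (proj₂ p)) k m)

∑-mExpansion-∷ : ∀ x es (F : RComp → ℤ) n →
  ∑ (mExpansion (suc n) (x ∷ es)) (λ p → proj₁ p * F (proj₂ p))
  ≡ ∑ (Flagged.peel (proj₂ x) es) (λ p → ∑ (mExpansion n (proj₂ p)) (λ q → proj₁ q * F ((proj₁ x ⊕ proj₁ p) ∷ proj₂ q)))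
∑-mExpansion-∷ x es F n =
  trans (∑-concatMap _ (Flagged.peel (proj₂ x) es) _)
        (∑-cong (Flagged.peel (proj₂ x) es) (λ p → ∑-map _ (mExpansion n (proj₂ p)) _))

mExpansion-correct : ∀ k (m : Vec Ñ k) n es → length es ≤ n → evalᶜ (mExpansion n es) k m ≡ Flagged.coeff es k m
mExpansion-correct k m n [] _ = trans (ℤP.+-identityʳ _) (ℤP.*-identityˡ _)
mExpansion-correct k m zero (x ∷ es) ()
mExpansion-correct zero V.[] (suc n) (x ∷ es) _ =
  trans (∑-mExpansion-∷ x es (λ α → Flagged.coeff (strictly α) 0 V.[]) n)
  (trans (∑-cong (Flagged.peel (proj₂ x) es) (λ p →
            trans (∑-cong (mExpansion n (proj₂ p)) (λ q → ℤP.*-zeroʳ (proj₁ q))) (∑-zero (mExpansion n (proj₂ p)))))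
         (∑-zero (Flagged.peel (proj₂ x) es)))
mExpansion-correct (suc k) (e V.∷ m) (suc n) (x ∷ es) (ℕ.s≤s size) =
  begin
    evalᶜ (mExpansion (suc n) (x ∷ es)) (suc k) (e V.∷ m)
  ≡⟨ ∑-mExpansion-∷ x es (λ α → Flagged.coeff (strictly α) (suc k) (e V.∷ m)) n ⟩
    ∑ Peels (λ p → ∑ (mExpansion n (proj₂ p)) (λ q → proj₁ q * Flagged.coeff (strictly ((proj₁ x ⊕ proj₁ p) ∷ proj₂ q)) (suc k) (e V.∷ m)))
  ≡⟨ ∑-cong Peels (λ p → trans (∑-cong (mExpansion n (proj₂ p)) (λ q → first-variable p q)) (split p)) ⟩
    ∑ Peels (λ p → skip * Later p + takes p * evalᶜ (mExpansion n (proj₂ p)) k m)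
  ≡⟨ trans (∑-+ Peels _ _) (cong (_+ ∑ Peels (λ p → takes p * evalᶜ (mExpansion n (proj₂ p)) k m)) (∑-*ˡ Peels skip Later)) ⟩
    skip * ∑ Peels Later + ∑ Peels (λ p → takes p * evalᶜ (mExpansion n (proj₂ p)) k m)
  ≡⟨ cong₂ _+_ (cong (skip *_) (trans (sym (∑-mExpansion-∷ x es (λ α → Flagged.coeff (strictly α) k m) n))
                                      (mExpansion-correct k m (suc n) (x ∷ es) (ℕ.s≤s size))))
               (∑-congAll (All.map (λ {p} short → cong (takes p *_) (mExpansion-correct k m n (proj₂ p) short))
                  (Flagged.peel-All (λ w → length w ≤ n) (ℕP.≤-trans (ℕP.n≤1+n _)) (proj₂ x) es size))) ⟩
    skip * Flagged.coeff (x ∷ es) k m + ∑ Peels (λ p → takes p * Flagged.coeff (proj₂ p) k m)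
  ≡⟨ sym (cong₂ _+_ (if-0≡𝟙* (does (nat 0 ≟Ñ e)) _)
                    (trans (∑-map _ Peels _) (∑-cong Peels (λ p → if-0≡𝟙* (does ((proj₁ x ⊕ proj₁ p) ≟Ñ e)) _)))) ⟩
    Flagged.coeff (x ∷ es) (suc k) (e V.∷ m)
  ∎
  where
  open ≡-Reasoning
  Peels = Flagged.peel (proj₂ x) es
  skip = 𝟙 (does (nat 0 ≟Ñ e))
  takes : Ñ × List (Ñ × Bool) → ℤ
  takes p = 𝟙 (does ((proj₁ x ⊕ proj₁ p) ≟Ñ e))
  Later : Ñ × List (Ñ × Bool) → ℤ
  Later p = ∑ (mExpansion n (proj₂ p)) (λ q → proj₁ q * Flagged.coeff (strictly ((proj₁ x ⊕ proj₁ p) ∷ proj₂ q)) k m)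
  distrib : ∀ c A B X Y → c * (A * X + B * Y) ≡ A * (c * X) + B * (c * Y)
  distrib = solve-∀
  first-variable : ∀ p q →
    proj₁ q * Flagged.coeff (strictly ((proj₁ x ⊕ proj₁ p) ∷ proj₂ q)) (suc k) (e V.∷ m)
    ≡ skip * (proj₁ q * Flagged.coeff (strictly ((proj₁ x ⊕ proj₁ p) ∷ proj₂ q)) k m)
      + takes p * (proj₁ q * Flagged.coeff (strictly (proj₂ q)) k m)
  first-variable p q =
    trans (cong (proj₁ q *_) (coeff-strictly-suc (proj₁ x ⊕ proj₁ p) (proj₂ q) k e m)) (distrib (proj₁ q) skip (takes p) _ _)
  split : ∀ p →
    ∑ (mExpansion n (proj₂ p)) (λ q → skip * (proj₁ q * Flagged.coeff (strictly ((proj₁ x ⊕ proj₁ p) ∷ proj₂ q)) k m)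
                                    + takes p * (proj₁ q * Flagged.coeff (strictly (proj₂ q)) k m))
    ≡ skip * Later p + takes p * evalᶜ (mExpansion n (proj₂ p)) k m
  split p = trans (∑-+ (mExpansion n (proj₂ p)) _ _)
                  (cong₂ _+_ (∑-*ˡ (mExpansion n (proj₂ p)) skip _) (∑-*ˡ (mExpansion n (proj₂ p)) (takes p) _))

⊕-nonzeroˡ : ∀ x y → x ≢ nat 0 → (x ⊕ y) ≢ nat 0
⊕-nonzeroˡ ε             ε             _   ()
⊕-nonzeroˡ ε             (nat zero)    _   ()
⊕-nonzeroˡ ε             (nat (suc j)) _   ()
⊕-nonzeroˡ (nat zero)    y             x≢0 _ = x≢0 refl
⊕-nonzeroˡ (nat (suc i)) ε             _   ()
⊕-nonzeroˡ (nat (suc i)) (nat j)       _   ()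

mExpansion-IsRComp : ∀ n es → All (λ x → proj₁ x ≢ nat 0) es → All (λ p → IsRComp (proj₂ p)) (mExpansion n es)
mExpansion-IsRComp n       []       _ = [] ∷ []
mExpansion-IsRComp zero    (x ∷ es) _ = []
mExpansion-IsRComp (suc n) (x ∷ es) (x≢0 ∷ es≢0) =
  AllP.concat⁺ (AllP.map⁺ (All.map (λ {p} p≢0 →
    AllP.map⁺ (All.map (λ rq → ⊕-nonzeroˡ (proj₁ x) (proj₁ p) x≢0 ∷ rq) (mExpansion-IsRComp n (proj₂ p) p≢0)))
    (Flagged.peel-All (All (λ x → proj₁ x ≢ nat 0)) All.tail (proj₂ x) es es≢0)))

eWord-nonzero : ∀ w → All (λ x → proj₁ x ≢ nat 0) (eWord w)
eWord-nonzero []               = []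
eWord-nonzero (-[1+ _ ] ∷ w)   = (λ ()) ∷ eWord-nonzero w
eWord-nonzero (ℤ.+ _ ∷ w)      = (λ ()) ∷ eWord-nonzero w

𝒟₂∈RQSym : ∀ n (σ : Word) → IsSignedPerm n σ →
           Σ (LinComb RComp) (λ L → All (λ p → IsRComp (proj₂ p)) L × (𝒟₂ σ ≈ evalM L))
𝒟₂∈RQSym _ σ _ = L , mExpansion-IsRComp _ (eWord σ) (eWord-nonzero σ) , 𝒟₂σ≈L
  where
  L = mExpansion (length (eWord σ)) (eWord σ)
  𝒟₂σ≈L : 𝒟₂ σ ≈ evalM L
  𝒟₂σ≈L k m =
    trans (𝒟₂≡coeff-eWord σ k m)
    (trans (sym (mExpansion-correct k m (length (eWord σ)) (eWord σ) ℕP.≤-refl))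
           (sym (trans (linS≡∑ M L k m) (∑-cong L (λ p → cong (proj₁ p *_) (M≡coeff (proj₂ p) k m))))))


theorem5p9 :
    -- unit
    (𝒟₂ ı ≈ 1ₛ)
    -- product
    × (∀ m n (σ τ : Word) → IsSignedPerm m σ → IsSignedPerm n τ →
        linS 𝒟₂ (σ ⋆̄ τ) ≈ (𝒟₂ σ *ₛ 𝒟₂ τ))
    -- 𝒟₂ takes values in RQSym
    × (∀ n (σ : Word) → IsSignedPerm n σ →
        Σ (LinComb RComp) (λ L → All (λ p → IsRComp (proj₂ p)) L × (𝒟₂ σ ≈ evalM L)))
    -- coproduct
    × (∀ n (σ : Word) → IsSignedPerm n σ → (L : LinComb RComp) →
        All (λ p → IsRComp (proj₂ p)) L → 𝒟₂ σ ≈ evalM L →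
        ΔR L ≈₂ 𝒟₂⊗𝒟₂Δ σ)
    -- counit
    × (∀ n (σ : Word) → IsSignedPerm n σ → (L : LinComb RComp) →
        All (λ p → IsRComp (proj₂ p)) L → 𝒟₂ σ ≈ evalM L →
        εR L ≡ εH σ)
theorem5p9 = unit , product , 𝒟₂∈RQSym , coproduct , counit
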